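{- For every odd integer $n\geq 9$, there exists a doubly Eulerian graph of order $n$ which is regular of degree $n-3$ (an edge-maximal doubly Eulerian graph of order $n$).
   Context: All graphs are finite, simple and connected. An Eulerian circuit is a closed trail traversing every edge exactly once. Let $G$ be Eulerian with $m$ edges and $u$ a vertex. Two Eulerian circuits $u,v_1,\ldots,v_{m-1},u$ and $u,w_1,\ldots,w_{m-1},u$ are avoiding if for every $1\le i\le m-1$, $v_i\neq w_i$ and $v_i$ is not adjacent to $w_i$. $G$ is doubly Eulerian if for every vertex $u$ there is a pair of avoiding Eulerian circuits starting and ending at $u$. For odd $n$, a doubly Eulerian graph of order $n$ is edge-maximal if it is regular of degree $n-3$ (the maximum possible). -}

module Defs where

open import Data.Nat using (ℕ; suc)
open import Data.Bool using (Bool; true; false; _∧_; _∨_)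
open import Data.Fin using (Fin; _≟_)
open import Data.List using (List; []; _∷_; _∷ʳ_; length; filterᵇ; head; last; allFin)
open import Data.List.Relation.Unary.All using (All)
open import Data.List.Relation.Binary.Pointwise using (Pointwise)
open import Data.Maybe using (just)
open import Data.Product using (_×_; _,_; Σ; ∃)
open import Relation.Binary.PropositionalEquality using (_≡_; _≢_)
open import Relation.Nullary.Decidable using (⌊_⌋)

record Graph (n : ℕ) : Set where
  field
    Adj   : Fin n → Fin n → Bool
    sym   : ∀ a b → Adj a b ≡ Adj b a
    irrefl : ∀ a → Adj a a ≡ false
open Graph public

steps : ∀ {A : Set} → List A → List (A × A)
steps []             = []
steps (x ∷ [])       = []
steps (x ∷ y ∷ xs)   = (x , y) ∷ steps (y ∷ xs)

IsWalk : ∀ {n} → Graph n → List (Fin n) → Set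
IsWalk G xs = All (λ p → Adj G (Data.Product.proj₁ p) (Data.Product.proj₂ p) ≡ true) (steps xs)

Connected : ∀ {n} → Graph n → Set
Connected {n} G = ∀ (a b : Fin n) →
  ∃ λ (xs : List (Fin n)) → head xs ≡ just a × last xs ≡ just b × IsWalk G xs

degree : ∀ {n} → Graph n → Fin n → ℕ
degree {n} G v = length (filterᵇ (Adj G v) (allFin n))

Regular : ∀ {n} → Graph n → ℕ → Set
Regular {n} G d = ∀ (v : Fin n) → degree G v ≡ d

sameEdge : ∀ {n} → Fin n → Fin n → Fin n × Fin n → Bool
sameEdge a b (x , y) = (⌊ x ≟ a ⌋ ∧ ⌊ y ≟ b ⌋) ∨ (⌊ x ≟ b ⌋ ∧ ⌊ y ≟ a ⌋)

edgeUses : ∀ {n} → Fin n → Fin n → List (Fin n) → ℕ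
edgeUses a b xs = length (filterᵇ (sameEdge a b) (steps xs))

-- The closed walk u, v₁, …, v_{k}, u (given by u and the inner list vs)
-- is an Eulerian circuit: a closed walk traversing every edge exactly once.
-- (Every step is an edge and every edge is used exactly once, so k = m - 1.)
EulerianCircuit : ∀ {n} → Graph n → Fin n → List (Fin n) → Set
EulerianCircuit {n} G u vs =
  IsWalk G (u ∷ (vs ∷ʳ u)) ×
  (∀ (a b : Fin n) → Adj G a b ≡ true → edgeUses a b (u ∷ (vs ∷ʳ u)) ≡ 1)

Avoiding : ∀ {n} → Graph n → List (Fin n) → List (Fin n) → Set
Avoiding G vs ws = Pointwise (λ v w → v ≢ w × Adj G v w ≡ false) vs ws

DoublyEulerian : ∀ {n} → Graph n → Set
DoublyEulerian {n} G = ∀ (u : Fin n) →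
  Σ (List (Fin n)) λ vs → Σ (List (Fin n)) λ ws →
    EulerianCircuit G u vs × EulerianCircuit G u ws × Avoiding G vs ws

-- The graphs are the complements of a cycle of length 3, 5 or 7 together with k disjoint triangles,
-- built as iterated joins G ⊕ K₃,₃ (K₃,₃ being the complement of two triangles); they are connected
-- and (n − 3)-regular. Turning every cycle by one step is an automorphism ρ sending each vertex to a
-- distinct non-neighbour, so any walk and its image under ρ avoid each other.
-- Suppose G has odd order and, at every vertex, a pair of avoiding Eulerian circuits visiting 0 and ρ 0
-- at the same position. In G ⊕ K₃,₃ there is a closed walk at 0 using exactly the edges outside G once:
-- for the three pairs (xₖ , yₖ) of a perfect matching of K₃,₃ it zigzags between xₖ and yₖ through all
-- of G, and the nine edges of K₃,₃ connect the zigzags. Splicing it into the first circuit at 0 and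
-- its ρ-image into the second at ρ 0 gives such a pair at the old vertices of G ⊕ K₃,₃. For the new
-- vertices of (G ⊕ K₃,₃) ⊕ K₃,₃ transport the pairs of the previous copy along the automorphism
-- exchanging the two copies. For the three smallest graphs, of order 9, 11 and 13, the pairs are listed
-- explicitly and checked by computation.

module Submission where

open import Defs
open import Data.Nat using (ℕ; _≤_; _∸_; _%_)
open import Data.Product using (Σ; _×_)
open import Relation.Binary.PropositionalEquality using (_≡_)

open import Data.Bool using (Bool; true; false; _∧_; _∨_; not; _xor_; T)
import Data.Bool as Bool
import Data.Bool.Properties as Boolₚ
open import Data.Fin as Fin using (Fin; zero; suc; _↑ˡ_; _↑ʳ_; splitAt; _≟_)
import Data.Fin.Properties as Finₚ
open import Data.Fin.Patterns using (0F; 1F; 2F; 3F; 4F; 5F)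
open import Data.List using (List; []; _∷_; _++_; _∷ʳ_; map; length; filterᵇ; allFin; tabulate; take; drop)
import Data.List.Properties as Listₚ
open import Data.List.Relation.Binary.Pointwise as PW using (Pointwise; []; _∷_)
import Data.List.Relation.Binary.Pointwise.Properties as PWₚ
open import Data.List.Relation.Unary.All as All using (All; []; _∷_)
import Data.List.Relation.Unary.All.Properties as Allₚ
open import Data.Nat using (zero; suc; _+_; _<ᵇ_; z≤n; s≤s)
open import Data.Nat.DivMod using (_mod_; [m+kn]%n≡m%n)
open import Data.Nat.ListAction using (sum)
import Data.Nat.Properties as ℕₚ
open import Algebra.Properties.CommutativeSemigroup ℕₚ.+-commutativeSemigroup using (x∙yz≈xz∙y)
open import Data.Nat.Tactic.RingSolver using (solve-∀)
open import Data.Product using (_,_; proj₁; proj₂)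
import Data.Product as Product
open import Data.Sum using (_⊎_; inj₁; inj₂)
import Data.Sum as Sum
open import Data.Vec using (Vec; lookup; _∷_; [])
open import Function using (_∘_)
open import Function.Definitions using (Injective)
open import Relation.Binary.PropositionalEquality
  using (refl; trans; cong; cong₂; subst; subst₂; _≢_; module ≡-Reasoning)
import Relation.Binary.PropositionalEquality as ≡
open import Relation.Nullary using (yes; no; Dec; ¬?)
open import Relation.Nullary.Decidable
  using (True; toWitness; _×-dec_; _→-dec_; ⌊_⌋; T?; dec-true; dec-false; isYes≗does)

open ≡-Reasoning

private
  variable
    A B : Set
    m n : ℕ

-- Counting

indicator : Bool → ℕ
indicator true  = 1
indicator false = 0

countᵇ : (A → Bool) → List A → ℕ
countᵇ p xs = length (filterᵇ p xs)

countᵇ-∷ : ∀ (p : A → Bool) x xs → countᵇ p (x ∷ xs) ≡ indicator (p x) + countᵇ p xs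
countᵇ-∷ p x xs with p x
... | true  = refl
... | false = refl

countᵇ-++ : ∀ (p : A → Bool) xs ys → countᵇ p (xs ++ ys) ≡ countᵇ p xs + countᵇ p ys
countᵇ-++ p xs ys =
  trans (cong length (Listₚ.filter-++ (T? ∘ p) xs ys)) (Listₚ.length-++ (filterᵇ p xs))

countᵇ-sum : ∀ (p : A → Bool) xs → countᵇ p xs ≡ sum (map (indicator ∘ p) xs)
countᵇ-sum p []       = refl
countᵇ-sum p (x ∷ xs) = trans (countᵇ-∷ p x xs) (cong (indicator (p x) +_) (countᵇ-sum p xs))

countᵇ-cong : ∀ {p q : A → Bool} → (∀ x → p x ≡ q x) → ∀ xs → countᵇ p xs ≡ countᵇ q xs
countᵇ-cong {p = p} {q} p≗q xs = begin
  countᵇ p xs                  ≡⟨ countᵇ-sum p xs ⟩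
  sum (map (indicator ∘ p) xs) ≡⟨ cong sum (Listₚ.map-cong (cong indicator ∘ p≗q) xs) ⟩
  sum (map (indicator ∘ q) xs) ≡⟨ countᵇ-sum q xs ⟨
  countᵇ q xs                  ∎

countᵇ-map : ∀ (p : B → Bool) (f : A → B) xs → countᵇ p (map f xs) ≡ countᵇ (p ∘ f) xs
countᵇ-map p f xs = begin
  countᵇ p (map f xs)                  ≡⟨ countᵇ-sum p (map f xs) ⟩
  sum (map (indicator ∘ p) (map f xs)) ≡⟨ cong sum (Listₚ.map-∘ xs) ⟨
  sum (map (indicator ∘ p ∘ f) xs)     ≡⟨ countᵇ-sum (p ∘ f) xs ⟨
  countᵇ (p ∘ f) xs                    ∎

countᵇ-none : ∀ (p : A → Bool) {xs} → All (λ x → p x ≡ false) xs → countᵇ p xs ≡ 0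
countᵇ-none p none = cong length (Listₚ.filter-none (T? ∘ p) (All.map (λ px≡false → subst T px≡false) none))

countᵇ-all : ∀ (p : A → Bool) {xs} → All (λ x → p x ≡ true) xs → countᵇ p xs ≡ length xs
countᵇ-all p all = cong length (Listₚ.filter-all (T? ∘ p) (All.map (λ px≡true → subst T (≡.sym px≡true) _) all))

steps-++ : ∀ (xs : List A) c zs → steps (xs ++ c ∷ zs) ≡ steps (xs ∷ʳ c) ++ steps (c ∷ zs)
steps-++ []           c zs = refl
steps-++ (x ∷ [])     c zs = refl
steps-++ (x ∷ y ∷ xs) c zs = cong ((x , y) ∷_) (steps-++ (y ∷ xs) c zs)

steps-map : ∀ (f : A → B) xs → steps (map f xs) ≡ map (Product.map f f) (steps xs)
steps-map f []           = refl
steps-map f (x ∷ [])     = refl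
steps-map f (x ∷ y ∷ xs) = cong ((f x , f y) ∷_) (steps-map f (y ∷ xs))

steps-splice : ∀ (xs : List A) c rs zs →
  steps (xs ++ c ∷ rs ++ c ∷ zs) ≡ steps (xs ∷ʳ c) ++ steps (c ∷ rs ∷ʳ c) ++ steps (c ∷ zs)
steps-splice xs c rs zs = begin
  steps (xs ++ c ∷ rs ++ c ∷ zs)                        ≡⟨ steps-++ xs c (rs ++ c ∷ zs) ⟩
  steps (xs ∷ʳ c) ++ steps ((c ∷ rs) ++ c ∷ zs)         ≡⟨ cong (steps (xs ∷ʳ c) ++_) (steps-++ (c ∷ rs) c zs) ⟩
  steps (xs ∷ʳ c) ++ steps (c ∷ rs ∷ʳ c) ++ steps (c ∷ zs) ∎

≟-refl : ∀ (x : Fin n) → ⌊ x ≟ x ⌋ ≡ true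
≟-refl x = trans (isYes≗does (x ≟ x)) (dec-true (x ≟ x) refl)

≟-≢ : ∀ {x y : Fin n} → x ≢ y → ⌊ x ≟ y ⌋ ≡ false
≟-≢ {x = x} {y} x≢y = trans (isYes≗does (x ≟ y)) (dec-false (x ≟ y) x≢y)

≟-injective : ∀ {f : Fin m → Fin n} → Injective _≡_ _≡_ f → ∀ x y → ⌊ f x ≟ f y ⌋ ≡ ⌊ x ≟ y ⌋
≟-injective {f = f} f-inj x y with x ≟ y
... | yes refl = ≟-refl (f x)
... | no  x≢y  = ≟-≢ (x≢y ∘ f-inj)

multiplicity : Fin n → List (Fin n) → ℕ
multiplicity b = countᵇ (λ x → ⌊ x ≟ b ⌋)

multiplicity-map : ∀ {f : Fin m → Fin n} → Injective _≡_ _≡_ f →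
  ∀ b xs → multiplicity (f b) (map f xs) ≡ multiplicity b xs
multiplicity-map {f = f} f-inj b xs =
  trans (countᵇ-map _ f xs) (countᵇ-cong (λ x → ≟-injective f-inj x b) xs)

multiplicity-allFin : ∀ (b : Fin n) → multiplicity b (allFin n) ≡ 1
multiplicity-allFin {suc n} b = begin
  multiplicity b (zero ∷ tabulate suc)
    ≡⟨ cong (multiplicity b ∘ (zero ∷_)) (Listₚ.map-tabulate (λ x → x) suc) ⟨
  multiplicity b (zero ∷ map suc (allFin n))
    ≡⟨ at b ⟩
  1 ∎
  where
  at : ∀ b → multiplicity b (zero ∷ map suc (allFin n)) ≡ 1
  at zero    = cong suc (trans (countᵇ-map _ suc (allFin n))
                              (countᵇ-none _ (All.universal (λ _ → refl) (allFin n))))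
  at (suc b) = trans (multiplicity-map Finₚ.suc-injective b (allFin n)) (multiplicity-allFin b)

-- Counting the uses of an edge

stepUses : Fin n → Fin n → Fin n → Fin n → ℕ
stepUses a b p q = indicator (sameEdge a b (p , q))

edgeUses-∷∷ : ∀ (a b p q : Fin n) xs → edgeUses a b (p ∷ q ∷ xs) ≡ stepUses a b p q + edgeUses a b (q ∷ xs)
edgeUses-∷∷ a b p q xs = countᵇ-∷ (sameEdge a b) (p , q) (steps (q ∷ xs))

sameEdge-false : ∀ {a b p q : Fin n} → p ≢ a ⊎ q ≢ b → p ≢ b ⊎ q ≢ a → sameEdge a b (p , q) ≡ false
sameEdge-false ab ba = cong₂ _∨_ (mismatch ab) (mismatch ba)
  where
  mismatch : ∀ {p q a b : Fin n} → p ≢ a ⊎ q ≢ b → ⌊ p ≟ a ⌋ ∧ ⌊ q ≟ b ⌋ ≡ false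
  mismatch (inj₁ p≢a) rewrite ≟-≢ p≢a = refl
  mismatch {p = p} {a = a} (inj₂ q≢b) rewrite ≟-≢ q≢b = Boolₚ.∧-zeroʳ ⌊ p ≟ a ⌋

stepUses-zero : ∀ {a b p q : Fin n} → p ≢ a ⊎ q ≢ b → p ≢ b ⊎ q ≢ a → stepUses a b p q ≡ 0
stepUses-zero ab ba = cong indicator (sameEdge-false ab ba)

sameEdge-from : ∀ {a b : Fin n} j → b ≢ a → sameEdge a b (a , j) ≡ ⌊ j ≟ b ⌋
sameEdge-from {a = a} {b} j b≢a rewrite ≟-refl a | ≟-≢ (b≢a ∘ ≡.sym) = Boolₚ.∨-identityʳ ⌊ j ≟ b ⌋

sameEdge-to : ∀ {a b : Fin n} j → b ≢ a → sameEdge a b (j , a) ≡ ⌊ j ≟ b ⌋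
sameEdge-to {a = a} {b} j b≢a
  rewrite ≟-refl a | ≟-≢ (b≢a ∘ ≡.sym) | Boolₚ.∧-zeroʳ ⌊ j ≟ a ⌋ = Boolₚ.∧-identityʳ ⌊ j ≟ b ⌋

sameEdge-sym : ∀ (a b : Fin n) s → sameEdge a b s ≡ sameEdge b a s
sameEdge-sym a b (p , q) = Boolₚ.∨-comm (⌊ p ≟ a ⌋ ∧ ⌊ q ≟ b ⌋) (⌊ p ≟ b ⌋ ∧ ⌊ q ≟ a ⌋)

sameEdge-map : ∀ {f : Fin m → Fin n} → Injective _≡_ _≡_ f →
  ∀ a b s → sameEdge (f a) (f b) (Product.map f f s) ≡ sameEdge a b s
sameEdge-map f-inj a b (p , q)
  rewrite ≟-injective f-inj p a | ≟-injective f-inj q b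
        | ≟-injective f-inj p b | ≟-injective f-inj q a = refl

edgeUses-sym : ∀ (a b : Fin n) xs → edgeUses a b xs ≡ edgeUses b a xs
edgeUses-sym a b xs = countᵇ-cong (sameEdge-sym a b) (steps xs)

edgeUses-map : ∀ {f : Fin m → Fin n} → Injective _≡_ _≡_ f →
  ∀ a b xs → edgeUses (f a) (f b) (map f xs) ≡ edgeUses a b xs
edgeUses-map {f = f} f-inj a b xs = begin
  countᵇ (sameEdge (f a) (f b)) (steps (map f xs))
    ≡⟨ cong (countᵇ (sameEdge (f a) (f b))) (steps-map f xs) ⟩
  countᵇ (sameEdge (f a) (f b)) (map (Product.map f f) (steps xs))
    ≡⟨ countᵇ-map (sameEdge (f a) (f b)) (Product.map f f) (steps xs) ⟩
  countᵇ (sameEdge (f a) (f b) ∘ Product.map f f) (steps xs)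
    ≡⟨ countᵇ-cong (sameEdge-map f-inj a b) (steps xs) ⟩
  countᵇ (sameEdge a b) (steps xs) ∎

All-steps : ∀ {P : A → Set} {xs} → All P xs → All (λ s → P (proj₁ s) × P (proj₂ s)) (steps xs)
All-steps []                 = []
All-steps (px ∷ [])          = []
All-steps (px ∷ py ∷ pxs) = (px , py) ∷ All-steps (py ∷ pxs)

edgeUses-absent : ∀ (a b : Fin n) {xs} → All (_≢ a) xs → edgeUses a b xs ≡ 0
edgeUses-absent a b absent =
  countᵇ-none (sameEdge a b) (All.map (λ (p≢a , q≢a) → sameEdge-false (inj₁ p≢a) (inj₂ q≢a)) (All-steps absent))

edgeUses-splice : ∀ (a b : Fin n) xs c rs zs →
  edgeUses a b (xs ++ c ∷ rs ++ c ∷ zs) ≡ edgeUses a b (xs ++ c ∷ zs) + edgeUses a b (c ∷ rs ∷ʳ c)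
edgeUses-splice a b xs c rs zs = begin
  count (steps (xs ++ c ∷ rs ++ c ∷ zs))
    ≡⟨ cong count (steps-splice xs c rs zs) ⟩
  count (steps (xs ∷ʳ c) ++ steps (c ∷ rs ∷ʳ c) ++ steps (c ∷ zs))
    ≡⟨ countᵇ-++ _ (steps (xs ∷ʳ c)) _ ⟩
  count (steps (xs ∷ʳ c)) + count (steps (c ∷ rs ∷ʳ c) ++ steps (c ∷ zs))
    ≡⟨ cong (count (steps (xs ∷ʳ c)) +_) (countᵇ-++ _ (steps (c ∷ rs ∷ʳ c)) _) ⟩
  count (steps (xs ∷ʳ c)) + (count (steps (c ∷ rs ∷ʳ c)) + count (steps (c ∷ zs)))
    ≡⟨ x∙yz≈xz∙y (count (steps (xs ∷ʳ c))) _ _ ⟩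
  (count (steps (xs ∷ʳ c)) + count (steps (c ∷ zs))) + count (steps (c ∷ rs ∷ʳ c))
    ≡⟨ cong (_+ count (steps (c ∷ rs ∷ʳ c))) (countᵇ-++ _ (steps (xs ∷ʳ c)) _) ⟨
  count (steps (xs ∷ʳ c) ++ steps (c ∷ zs)) + count (steps (c ∷ rs ∷ʳ c))
    ≡⟨ cong (λ ss → count ss + count (steps (c ∷ rs ∷ʳ c))) (steps-++ xs c zs) ⟨
  count (steps (xs ++ c ∷ zs)) + count (steps (c ∷ rs ∷ʳ c)) ∎
  where count = countᵇ (sameEdge a b)

walk-splice : ∀ (G : Graph n) xs c rs zs →
  IsWalk G (xs ++ c ∷ zs) → IsWalk G (c ∷ rs ∷ʳ c) → IsWalk G (xs ++ c ∷ rs ++ c ∷ zs)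
walk-splice G xs c rs zs walk loop rewrite steps-splice xs c rs zs | steps-++ xs c zs =
  Allₚ.++⁺ (Allₚ.++⁻ˡ (steps (xs ∷ʳ c)) walk) (Allₚ.++⁺ loop (Allₚ.++⁻ʳ (steps (xs ∷ʳ c)) walk))

-- Zigzag walks

zigzag : A → A → List A → List A
zigzag p q []       = []
zigzag p q (j ∷ js) = j ∷ q ∷ zigzag q p js

zigzagEnd : A → A → List A → A
zigzagEnd p q []       = p
zigzagEnd p q (j ∷ js) = zigzagEnd q p js

zigzagEnd-even : ∀ (p q : A) t js → length js ≡ t + t → zigzagEnd p q js ≡ p
zigzagEnd-even p q zero    []            refl = refl
zigzagEnd-even p q (suc t) (j ∷ k ∷ js) len =
  zigzagEnd-even p q t js (ℕₚ.suc-injective (trans (ℕₚ.suc-injective len) (ℕₚ.+-suc t t)))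
zigzagEnd-even p q (suc t) (j ∷ []) len with () ← trans (ℕₚ.suc-injective len) (ℕₚ.+-suc t t)

zigzagSteps : A → A → List A → List (A × A)
zigzagSteps p q []       = []
zigzagSteps p q (j ∷ js) = (p , j) ∷ (j , q) ∷ zigzagSteps q p js

steps-zigzag : ∀ (p q : A) js rs →
  steps (p ∷ zigzag p q js ++ rs) ≡ zigzagSteps p q js ++ steps (zigzagEnd p q js ∷ rs)
steps-zigzag p q []       rs = refl
steps-zigzag p q (j ∷ js) rs = cong (λ ss → (p , j) ∷ (j , q) ∷ ss) (steps-zigzag q p js rs)

AroundBoth : (A × A → Set) → A → A → A → Set
AroundBoth P p q j = (P (p , j) × P (j , p)) × (P (q , j) × P (j , q))

All-zigzagSteps : ∀ {P : A × A → Set} {p q} js → All (AroundBoth P p q) js → All P (zigzagSteps p q js)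
All-zigzagSteps []       []                            = []
All-zigzagSteps (j ∷ js) (((pj , jp) , (qj , jq)) ∷ h) =
  pj ∷ jq ∷ All-zigzagSteps js (All.map Product.swap h)

zigzagUses : Fin n → Fin n → Fin n → Fin n → List (Fin n) → ℕ
zigzagUses a b p q js = countᵇ (sameEdge a b) (zigzagSteps p q js)

edgeUses-zigzag : ∀ (a b p q : Fin n) js rs →
  edgeUses a b (p ∷ zigzag p q js ++ rs) ≡ zigzagUses a b p q js + edgeUses a b (zigzagEnd p q js ∷ rs)
edgeUses-zigzag a b p q js rs =
  trans (cong (countᵇ (sameEdge a b)) (steps-zigzag p q js rs)) (countᵇ-++ _ (zigzagSteps p q js) _)

walk-zigzag : ∀ (G : Graph n) p q js rs → All (λ j → Adj G p j ≡ true × Adj G q j ≡ true) js →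
  IsWalk G (zigzagEnd p q js ∷ rs) → IsWalk G (p ∷ zigzag p q js ++ rs)
walk-zigzag G p q js rs adj walk rewrite steps-zigzag p q js rs =
  Allₚ.++⁺ (All-zigzagSteps js (All.map both-ways adj)) walk
  where
  both-ways : ∀ {j} → Adj G p j ≡ true × Adj G q j ≡ true →
    AroundBoth (λ (x , y) → Adj G x y ≡ true) p q j
  both-ways {j} (pj , qj) = (pj , trans (Graph.sym G j p) pj) , (qj , trans (Graph.sym G j q) qj)

zigzagUses-∷ : ∀ (a b p q j : Fin n) js →
  zigzagUses a b p q (j ∷ js) ≡ stepUses a b p j + (stepUses a b j q + zigzagUses a b q p js)
zigzagUses-∷ a b p q j js = trans (countᵇ-∷ (sameEdge a b) (p , j) _)
  (cong (stepUses a b p j +_) (countᵇ-∷ (sameEdge a b) (j , q) _))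

zigzagUses-hub : ∀ (a b p q : Fin n) js → a ≡ p ⊎ a ≡ q → p ≢ q → b ≢ a → All (_≢ a) js →
  zigzagUses a b p q js ≡ multiplicity b js
zigzagUses-hub a b p q [] _ _ _ _ = refl
zigzagUses-hub a b .a q (j ∷ js) (inj₁ refl) a≢q b≢a (j≢a ∷ js≢a) = begin
  zigzagUses a b a q (j ∷ js)
    ≡⟨ zigzagUses-∷ a b a q j js ⟩
  stepUses a b a j + (stepUses a b j q + zigzagUses a b q a js)
    ≡⟨ cong₂ _+_ (cong indicator (sameEdge-from j b≢a))
                 (cong₂ _+_ (stepUses-zero (inj₁ j≢a) (inj₂ (a≢q ∘ ≡.sym)))
                            (zigzagUses-hub a b q a js (inj₂ refl) (a≢q ∘ ≡.sym) b≢a js≢a)) ⟩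
  indicator ⌊ j ≟ b ⌋ + multiplicity b js
    ≡⟨ countᵇ-∷ (λ x → ⌊ x ≟ b ⌋) j js ⟨
  multiplicity b (j ∷ js) ∎
zigzagUses-hub a b p .a (j ∷ js) (inj₂ refl) p≢a b≢a (j≢a ∷ js≢a) = begin
  zigzagUses a b p a (j ∷ js)
    ≡⟨ zigzagUses-∷ a b p a j js ⟩
  stepUses a b p j + (stepUses a b j a + zigzagUses a b a p js)
    ≡⟨ cong₂ _+_ (stepUses-zero (inj₁ p≢a) (inj₂ j≢a))
                 (cong₂ _+_ (cong indicator (sameEdge-to j b≢a))
                            (zigzagUses-hub a b a p js (inj₁ refl) (p≢a ∘ ≡.sym) b≢a js≢a)) ⟩
  indicator ⌊ j ≟ b ⌋ + multiplicity b js
    ≡⟨ countᵇ-∷ (λ x → ⌊ x ≟ b ⌋) j js ⟨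
  multiplicity b (j ∷ js) ∎

zigzagUses-miss : ∀ (a b p q : Fin n) {js} → p ≢ a → q ≢ a → All (_≢ a) js → zigzagUses a b p q js ≡ 0
zigzagUses-miss a b p q p≢a q≢a js≢a = countᵇ-none (sameEdge a b) (All-zigzagSteps _ (All.map miss js≢a))
  where
  miss : ∀ {j} → j ≢ a → AroundBoth (λ s → sameEdge a b s ≡ false) p q j
  miss j≢a = (sameEdge-false (inj₁ p≢a) (inj₂ j≢a) , sameEdge-false (inj₁ j≢a) (inj₂ p≢a))
           , (sameEdge-false (inj₁ q≢a) (inj₂ j≢a) , sameEdge-false (inj₁ j≢a) (inj₂ q≢a))

zigzagUses-outside : ∀ (a b p q : Fin n) js → p ≢ a → p ≢ b → q ≢ a → q ≢ b → zigzagUses a b p q js ≡ 0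
zigzagUses-outside a b p q js p≢a p≢b q≢a q≢b =
  countᵇ-none (sameEdge a b) (All-zigzagSteps js (All.universal outside js))
  where
  outside : ∀ j → AroundBoth (λ s → sameEdge a b s ≡ false) p q j
  outside j = (sameEdge-false {q = j} (inj₁ p≢a) (inj₁ p≢b) , sameEdge-false {p = j} (inj₂ p≢b) (inj₂ p≢a))
            , (sameEdge-false {q = j} (inj₁ q≢a) (inj₁ q≢b) , sameEdge-false {p = j} (inj₂ q≢b) (inj₂ q≢a))

zigzagUses-disjoint : ∀ (a b p q : Fin n) {js} → All (λ j → j ≢ a × j ≢ b) js → zigzagUses a b p q js ≡ 0
zigzagUses-disjoint a b p q disjoint =
  countᵇ-none (sameEdge a b) (All-zigzagSteps _ (All.map apart disjoint))
  where
  apart : ∀ {j} → j ≢ a × j ≢ b → AroundBoth (λ s → sameEdge a b s ≡ false) p q j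
  apart (j≢a , j≢b) =
    (sameEdge-false {p = p} (inj₂ j≢b) (inj₂ j≢a) , sameEdge-false {q = p} (inj₁ j≢a) (inj₁ j≢b)) ,
    (sameEdge-false {p = q} (inj₂ j≢b) (inj₂ j≢a) , sameEdge-false {q = q} (inj₁ j≢a) (inj₁ j≢b))

-- Joins of graphs

joinAdj : (Fin m → Fin m → Bool) → (Fin n → Fin n → Bool) → Fin m ⊎ Fin n → Fin m ⊎ Fin n → Bool
joinAdj A B (inj₁ x) (inj₁ y) = A x y
joinAdj A B (inj₁ x) (inj₂ j) = true
joinAdj A B (inj₂ i) (inj₁ y) = true
joinAdj A B (inj₂ i) (inj₂ j) = B i j

_⊕_ : Graph m → Graph n → Graph (m + n)
_⊕_ {m} G H = record
  { Adj    = λ a b → joinAdj (Adj G) (Adj H) (splitAt m a) (splitAt m b)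
  ; sym    = λ a b → symmetric (splitAt m a) (splitAt m b)
  ; irrefl = λ a → irreflexive (splitAt m a)
  }
  where
  symmetric : ∀ s t → joinAdj (Adj G) (Adj H) s t ≡ joinAdj (Adj G) (Adj H) t s
  symmetric (inj₁ x) (inj₁ y) = Graph.sym G x y
  symmetric (inj₁ x) (inj₂ j) = refl
  symmetric (inj₂ i) (inj₁ y) = refl
  symmetric (inj₂ i) (inj₂ j) = Graph.sym H i j
  irreflexive : ∀ s → joinAdj (Adj G) (Adj H) s s ≡ false
  irreflexive (inj₁ x) = irrefl G x
  irreflexive (inj₂ i) = irrefl H i

data Side (m n : ℕ) : Fin (m + n) → Set where
  left  : ∀ x → Side m n (x ↑ˡ n)
  right : ∀ j → Side m n (m ↑ʳ j)

side : ∀ m {n} (a : Fin (m + n)) → Side m n a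
side m a with splitAt m a in eq
... | inj₁ x = subst (Side m _) (Finₚ.splitAt⁻¹-↑ˡ eq) (left x)
... | inj₂ j = subst (Side m _) (Finₚ.splitAt⁻¹-↑ʳ eq) (right j)

↑ˡ≢↑ʳ : ∀ (x : Fin m) (j : Fin n) → x ↑ˡ n ≢ m ↑ʳ j
↑ˡ≢↑ʳ {m} {n} x j eq
  with () ← trans (≡.sym (Finₚ.splitAt-↑ˡ m x n)) (trans (cong (splitAt m) eq) (Finₚ.splitAt-↑ʳ m n j))

tabulate-+ : ∀ m n (f : Fin (m + n) → A) →
  tabulate f ≡ tabulate (f ∘ (_↑ˡ n)) ++ tabulate (f ∘ (m ↑ʳ_))
tabulate-+ zero    n f = refl
tabulate-+ (suc m) n f = cong (f zero ∷_) (tabulate-+ m n (f ∘ suc))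

allFin-+ : ∀ m n → allFin (m + n) ≡ map (_↑ˡ n) (allFin m) ++ map (m ↑ʳ_) (allFin n)
allFin-+ m n = trans (tabulate-+ m n (λ a → a))
  (cong₂ _++_ (≡.sym (Listₚ.map-tabulate (λ x → x) (_↑ˡ n))) (≡.sym (Listₚ.map-tabulate (λ j → j) (m ↑ʳ_))))

module _ (G : Graph m) (H : Graph n) where

  ⊕-left-left : ∀ x y → Adj (G ⊕ H) (x ↑ˡ n) (y ↑ˡ n) ≡ Adj G x y
  ⊕-left-left x y rewrite Finₚ.splitAt-↑ˡ m x n | Finₚ.splitAt-↑ˡ m y n = refl

  ⊕-left-right : ∀ x j → Adj (G ⊕ H) (x ↑ˡ n) (m ↑ʳ j) ≡ true
  ⊕-left-right x j rewrite Finₚ.splitAt-↑ˡ m x n | Finₚ.splitAt-↑ʳ m n j = refl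

  ⊕-right-left : ∀ i y → Adj (G ⊕ H) (m ↑ʳ i) (y ↑ˡ n) ≡ true
  ⊕-right-left i y rewrite Finₚ.splitAt-↑ʳ m n i | Finₚ.splitAt-↑ˡ m y n = refl

  ⊕-right-right : ∀ i j → Adj (G ⊕ H) (m ↑ʳ i) (m ↑ʳ j) ≡ Adj H i j
  ⊕-right-right i j rewrite Finₚ.splitAt-↑ʳ m n i | Finₚ.splitAt-↑ʳ m n j = refl

  ⊕-connected : Fin m → Fin n → Connected (G ⊕ H)
  ⊕-connected x₀ j₀ a b with side m a | side m b
  ... | left x  | left y  = ((x ↑ˡ n) ∷ (m ↑ʳ j₀) ∷ (y ↑ˡ n) ∷ []) , refl , refl ,
                            ⊕-left-right x j₀ ∷ ⊕-right-left j₀ y ∷ []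
  ... | left x  | right j = ((x ↑ˡ n) ∷ (m ↑ʳ j) ∷ []) , refl , refl , ⊕-left-right x j ∷ []
  ... | right i | left y  = ((m ↑ʳ i) ∷ (y ↑ˡ n) ∷ []) , refl , refl , ⊕-right-left i y ∷ []
  ... | right i | right j = ((m ↑ʳ i) ∷ (x₀ ↑ˡ n) ∷ (m ↑ʳ j) ∷ []) , refl , refl ,
                            ⊕-right-left i x₀ ∷ ⊕-left-right x₀ j ∷ []

  ⊕-degree : ∀ a → degree (G ⊕ H) a ≡
    countᵇ (Adj (G ⊕ H) a ∘ (_↑ˡ n)) (allFin m) + countᵇ (Adj (G ⊕ H) a ∘ (m ↑ʳ_)) (allFin n)
  ⊕-degree a = begin
    countᵇ (Adj (G ⊕ H) a) (allFin (m + n))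
      ≡⟨ cong (countᵇ (Adj (G ⊕ H) a)) (allFin-+ m n) ⟩
    countᵇ (Adj (G ⊕ H) a) (map (_↑ˡ n) (allFin m) ++ map (m ↑ʳ_) (allFin n))
      ≡⟨ countᵇ-++ _ (map (_↑ˡ n) (allFin m)) _ ⟩
    countᵇ (Adj (G ⊕ H) a) (map (_↑ˡ n) (allFin m)) + countᵇ (Adj (G ⊕ H) a) (map (m ↑ʳ_) (allFin n))
      ≡⟨ cong₂ _+_ (countᵇ-map _ (_↑ˡ n) (allFin m)) (countᵇ-map _ (m ↑ʳ_) (allFin n)) ⟩
    countᵇ (Adj (G ⊕ H) a ∘ (_↑ˡ n)) (allFin m) + countᵇ (Adj (G ⊕ H) a ∘ (m ↑ʳ_)) (allFin n) ∎

  ⊕-degree-left : ∀ x → degree (G ⊕ H) (x ↑ˡ n) ≡ degree G x + n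
  ⊕-degree-left x = trans (⊕-degree (x ↑ˡ n)) (cong₂ _+_
    (countᵇ-cong (⊕-left-left x) (allFin m))
    (trans (countᵇ-all _ (All.universal (⊕-left-right x) (allFin n))) (Listₚ.length-tabulate (λ j → j))))

  ⊕-degree-right : ∀ j → degree (G ⊕ H) (m ↑ʳ j) ≡ m + degree H j
  ⊕-degree-right j = trans (⊕-degree (m ↑ʳ j)) (cong₂ _+_
    (trans (countᵇ-all _ (All.universal (⊕-right-left j) (allFin m))) (Listₚ.length-tabulate (λ x → x)))
    (countᵇ-cong (⊕-right-right j) (allFin n)))

-- Automorphisms

record Automorphism (G : Graph n) : Set where
  field
    to from   : Fin n → Fin n
    from-to   : ∀ x → from (to x) ≡ x
    to-from   : ∀ x → to (from x) ≡ x
    adjacency : ∀ a b → Adj G (to a) (to b) ≡ Adj G a b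

  to-injective : Injective _≡_ _≡_ to
  to-injective {x} {y} eq = trans (≡.sym (from-to x)) (trans (cong from eq) (from-to y))

  from-adjacency : ∀ a b → Adj G (from a) (from b) ≡ Adj G a b
  from-adjacency a b = trans (≡.sym (adjacency (from a) (from b))) (cong₂ (Adj G) (to-from a) (to-from b))

  walk-map : ∀ xs → IsWalk G xs → IsWalk G (map to xs)
  walk-map xs walk rewrite steps-map to xs =
    Allₚ.map⁺ (All.map (λ {(a , b)} ab → trans (adjacency a b) ab) walk)

  edgeUses-map-to : ∀ a b xs → edgeUses a b (map to xs) ≡ edgeUses (from a) (from b) xs
  edgeUses-map-to a b xs = begin
    edgeUses a b (map to xs)
      ≡⟨ cong₂ (λ a′ b′ → edgeUses a′ b′ (map to xs)) (to-from a) (to-from b) ⟨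
    edgeUses (to (from a)) (to (from b)) (map to xs)
      ≡⟨ edgeUses-map to-injective (from a) (from b) xs ⟩
    edgeUses (from a) (from b) xs ∎

  eulerian-map : ∀ u vs → EulerianCircuit G u vs → EulerianCircuit G (to u) (map to vs)
  eulerian-map u vs (walk , once) = subst (IsWalk G) closed (walk-map _ walk) , λ a b ab → begin
    edgeUses a b (to u ∷ map to vs ∷ʳ to u) ≡⟨ cong (edgeUses a b) closed ⟨
    edgeUses a b (map to (u ∷ vs ∷ʳ u))     ≡⟨ edgeUses-map-to a b (u ∷ vs ∷ʳ u) ⟩
    edgeUses (from a) (from b) (u ∷ vs ∷ʳ u) ≡⟨ once (from a) (from b) (trans (from-adjacency a b) ab) ⟩
    1 ∎
    where
    closed : map to (u ∷ vs ∷ʳ u) ≡ to u ∷ map to vs ∷ʳ to u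
    closed = cong (to u ∷_) (Listₚ.map-++ to vs (u ∷ []))

  avoiding-map : ∀ {vs ws} → Avoiding G vs ws → Avoiding G (map to vs) (map to ws)
  avoiding-map = PW.map⁺ to to ∘ PW.map (λ {v} {w} (v≢w , vw) → v≢w ∘ to-injective , trans (adjacency v w) vw)

record Rotation (G : Graph n) : Set where
  field
    automorphism : Automorphism G
  open Automorphism automorphism public
  field
    moves        : ∀ a → a ≢ to a
    non-adjacent : ∀ a → Adj G a (to a) ≡ false

  avoiding-rotated : ∀ xs → Avoiding G xs (map to xs)
  avoiding-rotated []       = []
  avoiding-rotated (x ∷ xs) = (moves x , non-adjacent x) ∷ avoiding-rotated xs

_⊕ᶠ_ : (Fin m → Fin m) → (Fin n → Fin n) → Fin (m + n) → Fin (m + n)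
_⊕ᶠ_ {m} {n} f g = Fin.join m n ∘ Sum.map f g ∘ splitAt m

⊕ᶠ-left : ∀ (f : Fin m → Fin m) (g : Fin n → Fin n) x → (f ⊕ᶠ g) (x ↑ˡ n) ≡ f x ↑ˡ n
⊕ᶠ-left {m} {n} f g x rewrite Finₚ.splitAt-↑ˡ m x n = refl

⊕ᶠ-right : ∀ (f : Fin m → Fin m) (g : Fin n → Fin n) j → (f ⊕ᶠ g) (m ↑ʳ j) ≡ m ↑ʳ g j
⊕ᶠ-right {m} {n} f g j rewrite Finₚ.splitAt-↑ʳ m n j = refl

module _ {G : Graph m} {H : Graph n} where

  _⊕ᵃ_ : Automorphism G → Automorphism H → Automorphism (G ⊕ H)
  φ ⊕ᵃ ψ = record
    { to        = φ.to ⊕ᶠ ψ.to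
    ; from      = φ.from ⊕ᶠ ψ.from
    ; from-to   = inverse φ.to φ.from ψ.to ψ.from φ.from-to ψ.from-to
    ; to-from   = inverse φ.from φ.to ψ.from ψ.to φ.to-from ψ.to-from
    ; adjacency = adjacency
    }
    where
    module φ = Automorphism φ
    module ψ = Automorphism ψ
    inverse : ∀ (f f′ : Fin m → Fin m) (g g′ : Fin n → Fin n) → (∀ x → f′ (f x) ≡ x) → (∀ j → g′ (g j) ≡ j) →
      ∀ a → (f′ ⊕ᶠ g′) ((f ⊕ᶠ g) a) ≡ a
    inverse f f′ g g′ f′f g′g a with side m a
    ... | left x  rewrite ⊕ᶠ-left f g x | ⊕ᶠ-left f′ g′ (f x) = cong (_↑ˡ n) (f′f x)
    ... | right j rewrite ⊕ᶠ-right f g j | ⊕ᶠ-right f′ g′ (g j) = cong (m ↑ʳ_) (g′g j)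
    adjacency : ∀ a b → Adj (G ⊕ H) ((φ.to ⊕ᶠ ψ.to) a) ((φ.to ⊕ᶠ ψ.to) b) ≡ Adj (G ⊕ H) a b
    adjacency a b with side m a | side m b
    ... | left x  | left y  rewrite ⊕ᶠ-left φ.to ψ.to x | ⊕ᶠ-left φ.to ψ.to y
                                  | ⊕-left-left G H (φ.to x) (φ.to y) | ⊕-left-left G H x y = φ.adjacency x y
    ... | left x  | right j rewrite ⊕ᶠ-left φ.to ψ.to x | ⊕ᶠ-right φ.to ψ.to j
                                  | ⊕-left-right G H (φ.to x) (ψ.to j) | ⊕-left-right G H x j = refl
    ... | right i | left y  rewrite ⊕ᶠ-right φ.to ψ.to i | ⊕ᶠ-left φ.to ψ.to y
                                  | ⊕-right-left G H (ψ.to i) (φ.to y) | ⊕-right-left G H i y = refl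
    ... | right i | right j rewrite ⊕ᶠ-right φ.to ψ.to i | ⊕ᶠ-right φ.to ψ.to j
                                  | ⊕-right-right G H (ψ.to i) (ψ.to j) | ⊕-right-right G H i j = ψ.adjacency i j

  _⊕ʳ_ : Rotation G → Rotation H → Rotation (G ⊕ H)
  ρ ⊕ʳ τ = record
    { automorphism = ρ.automorphism ⊕ᵃ τ.automorphism
    ; moves        = moves
    ; non-adjacent = non-adjacent
    }
    where
    module ρ = Rotation ρ
    module τ = Rotation τ
    moves : ∀ a → a ≢ (ρ.to ⊕ᶠ τ.to) a
    moves a with side m a
    ... | left x  rewrite ⊕ᶠ-left ρ.to τ.to x = ρ.moves x ∘ Finₚ.↑ˡ-injective n x (ρ.to x)
    ... | right j rewrite ⊕ᶠ-right ρ.to τ.to j = τ.moves j ∘ Finₚ.↑ʳ-injective m j (τ.to j)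
    non-adjacent : ∀ a → Adj (G ⊕ H) a ((ρ.to ⊕ᶠ τ.to) a) ≡ false
    non-adjacent a with side m a
    ... | left x  rewrite ⊕ᶠ-left ρ.to τ.to x = trans (⊕-left-left G H x (ρ.to x)) (ρ.non-adjacent x)
    ... | right j rewrite ⊕ᶠ-right ρ.to τ.to j = trans (⊕-right-right G H j (τ.to j)) (τ.non-adjacent j)

data Side₂ (m n : ℕ) : Fin (m + n + n) → Set where
  base   : ∀ x → Side₂ m n ((x ↑ˡ n) ↑ˡ n)
  middle : ∀ i → Side₂ m n ((m ↑ʳ i) ↑ˡ n)
  top    : ∀ i → Side₂ m n ((m + n) ↑ʳ i)

side₂ : ∀ m {n} (a : Fin (m + n + n)) → Side₂ m n a
side₂ m {n} a with side (m + n) a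
... | right i = top i
... | left x with side m x
...   | left y  = base y
...   | right i = middle i

-- exchanges the two copies of H in (G ⊕ H) ⊕ H
swapLast : ∀ m n → Fin (m + n + n) → Fin (m + n + n)
swapLast m n a = Sum.[ Sum.[ (λ x → (x ↑ˡ n) ↑ˡ n) , (m + n) ↑ʳ_ ]′ ∘ splitAt m , (λ i → (m ↑ʳ i) ↑ˡ n) ]′
  (splitAt (m + n) a)

swapLast-base : ∀ {m n} (x : Fin m) → swapLast m n ((x ↑ˡ n) ↑ˡ n) ≡ (x ↑ˡ n) ↑ˡ n
swapLast-base {m = m} {n = n} x rewrite Finₚ.splitAt-↑ˡ (m + n) (x ↑ˡ n) n | Finₚ.splitAt-↑ˡ m x n = refl

swapLast-middle : ∀ {m n} (i : Fin n) → swapLast m n ((m ↑ʳ i) ↑ˡ n) ≡ (m + n) ↑ʳ i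
swapLast-middle {m = m} {n = n} i rewrite Finₚ.splitAt-↑ˡ (m + n) (m ↑ʳ i) n | Finₚ.splitAt-↑ʳ m n i = refl

swapLast-top : ∀ {m n} (i : Fin n) → swapLast m n ((m + n) ↑ʳ i) ≡ (m ↑ʳ i) ↑ˡ n
swapLast-top {m = m} {n = n} i rewrite Finₚ.splitAt-↑ʳ (m + n) n i = refl

swapLast-involutive : ∀ {m n} (a : Fin (m + n + n)) → swapLast m n (swapLast m n a) ≡ a
swapLast-involutive {m = m} {n = n} a with side₂ m a
... | base x   rewrite swapLast-base {n = n} x = swapLast-base x
... | middle i rewrite swapLast-middle {m = m} i = swapLast-top {m = m} i
... | top i    rewrite swapLast-top {m = m} i = swapLast-middle {m = m} i

swapLast-automorphism : ∀ (G : Graph m) (H : Graph n) → Automorphism ((G ⊕ H) ⊕ H)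
swapLast-automorphism {m} {n} G H = record
  { to        = swapLast m n
  ; from      = swapLast m n
  ; from-to   = swapLast-involutive {m} {n}
  ; to-from   = swapLast-involutive {m} {n}
  ; adjacency = adjacency
  }
  where
  K = G ⊕ H
  blockAdj : ∀ {a b} → Side₂ m n a → Side₂ m n b → Bool
  blockAdj (base x)   (base y)   = Adj G x y
  blockAdj (middle i) (middle j) = Adj H i j
  blockAdj (top i)    (top j)    = Adj H i j
  blockAdj _          _          = true
  blockAdj-correct : ∀ {a b} (sa : Side₂ m n a) (sb : Side₂ m n b) → Adj (K ⊕ H) a b ≡ blockAdj sa sb
  blockAdj-correct (base x)   (base y)   = trans (⊕-left-left K H _ _) (⊕-left-left G H x y)
  blockAdj-correct (base x)   (middle j) = trans (⊕-left-left K H _ _) (⊕-left-right G H x j)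
  blockAdj-correct (base x)   (top j)    = ⊕-left-right K H _ j
  blockAdj-correct (middle i) (base y)   = trans (⊕-left-left K H _ _) (⊕-right-left G H i y)
  blockAdj-correct (middle i) (middle j) = trans (⊕-left-left K H _ _) (⊕-right-right G H i j)
  blockAdj-correct (middle i) (top j)    = ⊕-left-right K H _ j
  blockAdj-correct (top i)    (base y)   = ⊕-right-left K H i _
  blockAdj-correct (top i)    (middle j) = ⊕-right-left K H i _
  blockAdj-correct (top i)    (top j)    = ⊕-right-right K H i j
  same-blocks : ∀ {a b a′ b′} (sa : Side₂ m n a) (sb : Side₂ m n b) (sa′ : Side₂ m n a′) (sb′ : Side₂ m n b′) →
    blockAdj sa sb ≡ blockAdj sa′ sb′ → Adj (K ⊕ H) a b ≡ Adj (K ⊕ H) a′ b′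
  same-blocks sa sb sa′ sb′ eq = trans (blockAdj-correct sa sb) (trans eq (≡.sym (blockAdj-correct sa′ sb′)))
  adjacency : ∀ a b → Adj (K ⊕ H) (swapLast m n a) (swapLast m n b) ≡ Adj (K ⊕ H) a b
  adjacency a b with side₂ m a | side₂ m b
  ... | base x   | base y   rewrite swapLast-base {n = n} x | swapLast-base {n = n} y = refl
  ... | base x   | middle j rewrite swapLast-base {n = n} x | swapLast-middle {m = m} j =
    same-blocks (base x) (top j) (base x) (middle j) refl
  ... | base x   | top j    rewrite swapLast-base {n = n} x | swapLast-top {m = m} j =
    same-blocks (base x) (middle j) (base x) (top j) refl
  ... | middle i | base y   rewrite swapLast-middle {m = m} i | swapLast-base {n = n} y =
    same-blocks (top i) (base y) (middle i) (base y) refl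
  ... | middle i | middle j rewrite swapLast-middle {m = m} i | swapLast-middle {m = m} j =
    same-blocks (top i) (top j) (middle i) (middle j) refl
  ... | middle i | top j    rewrite swapLast-middle {m = m} i | swapLast-top {m = m} j =
    same-blocks (top i) (middle j) (middle i) (top j) refl
  ... | top i    | base y   rewrite swapLast-top {m = m} i | swapLast-base {n = n} y =
    same-blocks (middle i) (base y) (top i) (base y) refl
  ... | top i    | middle j rewrite swapLast-top {m = m} i | swapLast-middle {m = m} j =
    same-blocks (middle i) (top j) (top i) (middle j) refl
  ... | top i    | top j    rewrite swapLast-top {m = m} i | swapLast-top {m = m} j =
    same-blocks (middle i) (middle j) (top i) (top j) refl

decide₁ : ∀ {P : Fin n → Set} (P? : ∀ a → Dec (P a)) → {True (Finₚ.all? P?)} → ∀ a → P a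
decide₁ P? {t} = toWitness t

decide₂ : ∀ {P : Fin n → Fin n → Set} (P? : ∀ a b → Dec (P a b)) →
  {True (Finₚ.all? (λ a → Finₚ.all? (P? a)))} → ∀ a b → P a b
decide₂ P? {t} a b = toWitness t a b

-- K₃,₃ and complements of cycles

K₃₃ : Graph 6
K₃₃ = record
  { Adj    = λ i j → firstSide i xor firstSide j
  ; sym    = λ i j → Boolₚ.xor-comm (firstSide i) (firstSide j)
  ; irrefl = λ i → Boolₚ.xor-same (firstSide i)
  }
  where
  firstSide : Fin 6 → Bool
  firstSide i = Fin.toℕ i <ᵇ 3

K₃₃-regular : Regular K₃₃ 3
K₃₃-regular = decide₁ (λ j → degree K₃₃ j ℕₚ.≟ 3)

rotateSides : Fin 6 → Fin 6
rotateSides 0F = 1F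
rotateSides 1F = 2F
rotateSides 2F = 0F
rotateSides 3F = 4F
rotateSides 4F = 5F
rotateSides 5F = 3F

rotateSides⁻¹ : Fin 6 → Fin 6
rotateSides⁻¹ 0F = 2F
rotateSides⁻¹ 1F = 0F
rotateSides⁻¹ 2F = 1F
rotateSides⁻¹ 3F = 5F
rotateSides⁻¹ 4F = 3F
rotateSides⁻¹ 5F = 4F

K₃₃-rotation : Rotation K₃₃
K₃₃-rotation = record
  { automorphism = record
    { to        = rotateSides
    ; from      = rotateSides⁻¹
    ; from-to   = decide₁ (λ i → rotateSides⁻¹ (rotateSides i) ≟ i)
    ; to-from   = decide₁ (λ i → rotateSides (rotateSides⁻¹ i) ≟ i)
    ; adjacency = decide₂ (λ i j → Adj K₃₃ (rotateSides i) (rotateSides j) Bool.≟ Adj K₃₃ i j)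
    }
  ; moves        = decide₁ (λ i → ¬? (i ≟ rotateSides i))
  ; non-adjacent = decide₁ (λ i → Adj K₃₃ i (rotateSides i) Bool.≟ false)
  }

next : Fin (suc n) → Fin (suc n)
next {n} i = suc (Fin.toℕ i) mod suc n

previous : Fin (suc n) → Fin (suc n)
previous {n} i = (Fin.toℕ i + n) mod suc n

⌊≟⌋-sym : ∀ (x y : Fin n) → ⌊ x ≟ y ⌋ ≡ ⌊ y ≟ x ⌋
⌊≟⌋-sym x y with x ≟ y
... | yes refl = ≡.sym (≟-refl x)
... | no  x≢y  = ≡.sym (≟-≢ (x≢y ∘ ≡.sym))

cycleComplement : ∀ n → Graph (suc n)
cycleComplement n = record
  { Adj    = λ x y → not (⌊ x ≟ y ⌋ ∨ ⌊ next x ≟ y ⌋ ∨ ⌊ next y ≟ x ⌋)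
  ; sym    = λ x y → cong not (cong₂ _∨_ (⌊≟⌋-sym x y) (Boolₚ.∨-comm ⌊ next x ≟ y ⌋ ⌊ next y ≟ x ⌋))
  ; irrefl = λ x → cong (λ b → not (b ∨ ⌊ next x ≟ x ⌋ ∨ ⌊ next x ≟ x ⌋)) (≟-refl x)
  }

cycleComplement-rotation : ∀ n
  {_ : True (Finₚ.all? λ (x : Fin (suc n)) → previous (next x) ≟ x)}
  {_ : True (Finₚ.all? λ (x : Fin (suc n)) → next (previous x) ≟ x)}
  {_ : True (Finₚ.all? λ x → Finₚ.all? λ y →
         Adj (cycleComplement n) (next x) (next y) Bool.≟ Adj (cycleComplement n) x y)}
  {_ : True (Finₚ.all? λ (x : Fin (suc n)) → ¬? (x ≟ next x))} →
  Rotation (cycleComplement n)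
cycleComplement-rotation n {from-to} {to-from} {adjacency} {moves} = record
  { automorphism = record
    { to        = next
    ; from      = previous
    ; from-to   = toWitness from-to
    ; to-from   = toWitness to-from
    ; adjacency = λ x y → toWitness adjacency x y
    }
  ; moves        = toWitness moves
  ; non-adjacent = λ x → trans (cong (λ b → not (⌊ x ≟ next x ⌋ ∨ b ∨ ⌊ next (next x) ≟ x ⌋)) (≟-refl (next x)))
                                 (cong not (Boolₚ.∨-zeroʳ ⌊ x ≟ next x ⌋))
  }

-- the nine edges of K₃,₃, in the order the gadget below traverses them
k₃₃Steps : List (Fin 6 × Fin 6)
k₃₃Steps = (3F , 1F) ∷ (4F , 2F) ∷ (5F , 0F) ∷ (0F , 3F) ∷ (3F , 2F) ∷ (2F , 5F) ∷ (5F , 1F) ∷ (1F , 4F)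
         ∷ (4F , 0F) ∷ []

k₃₃Steps-once : ∀ i j → Adj K₃₃ i j ≡ true → countᵇ (sameEdge i j) k₃₃Steps ≡ 1
k₃₃Steps-once = decide₂ (λ i j → (Adj K₃₃ i j Bool.≟ true) →-dec (countᵇ (sameEdge i j) k₃₃Steps ℕₚ.≟ 1))

-- The gadget

module Blocks (r : ℕ) where

  V : Set
  V = Fin (suc r + 6)

  old : Fin (suc r) → V
  old x = x ↑ˡ 6

  new : Fin 6 → V
  new i = suc r ↑ʳ i

  old≢new : ∀ {x i} → old x ≢ new i
  old≢new {x} {i} = ↑ˡ≢↑ʳ x i

  new≢old : ∀ {i x} → new i ≢ old x
  new≢old = old≢new ∘ ≡.sym

  old-injective : Injective _≡_ _≡_ old
  old-injective = Finₚ.↑ˡ-injective 6 _ _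

  new-injective : Injective _≡_ _≡_ new
  new-injective = Finₚ.↑ʳ-injective (suc r) _ _

  record NewEdgeTour (W : List V) : Set where
    field
      old-old : ∀ x y → edgeUses (old x) (old y) W ≡ 0
      new-old : ∀ i y → edgeUses (new i) (old y) W ≡ 1
      new-new : ∀ i j → Adj K₃₃ i j ≡ true → edgeUses (new i) (new j) W ≡ 1

  newEdgeTour-map : ∀ {H : Graph (suc r)} (φ : Automorphism H) (ψ : Automorphism K₃₃) {W} →
    NewEdgeTour W → NewEdgeTour (map (Automorphism.to (φ ⊕ᵃ ψ)) W)
  newEdgeTour-map φ ψ {W} tour = record
    { old-old = λ x y → moved (old x) (old y) (from-old x) (from-old y) (tour.old-old _ _)
    ; new-old = λ i y → moved (new i) (old y) (from-new i) (from-old y) (tour.new-old _ _)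
    ; new-new = λ i j ij →
        moved (new i) (new j) (from-new i) (from-new j) (tour.new-new _ _ (trans (ψ.from-adjacency i j) ij))
    }
    where
    module tour = NewEdgeTour tour
    module φ = Automorphism φ
    module ψ = Automorphism ψ
    module φψ = Automorphism (φ ⊕ᵃ ψ)
    from-old : ∀ x → φψ.from (old x) ≡ old (φ.from x)
    from-old = ⊕ᶠ-left φ.from ψ.from
    from-new : ∀ i → φψ.from (new i) ≡ new (ψ.from i)
    from-new = ⊕ᶠ-right φ.from ψ.from
    moved : ∀ a b {a′ b′ k} → φψ.from a ≡ a′ → φψ.from b ≡ b′ →
      edgeUses a′ b′ W ≡ k → edgeUses a b (map φψ.to W) ≡ k
    moved a b refl refl uses = trans (φψ.edgeUses-map-to a b W) uses

-- A closed walk at vertex 0 of G ⊕ K₃₃ using every edge outside G once: it zigzags between xₖ and yₖ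
-- through all vertices of G (ending at yₖ needs the order of G to be odd), and between the zigzags it
-- traverses the edges of K₃,₃.
module Gadget {r t : ℕ} (G : Graph (suc r)) (r-even : r ≡ t + t) where

  open Blocks r

  c x₁ x₂ x₃ y₁ y₂ y₃ : V
  c  = old zero
  x₁ = new 0F
  x₂ = new 1F
  x₃ = new 2F
  y₁ = new 3F
  y₂ = new 4F
  y₃ = new 5F

  others allOld : List V
  others = map old (tabulate suc)
  allOld = c ∷ others

  gadget : List V → List V
  gadget rest = y₁ ∷ zigzag y₁ x₁ others ++ x₂ ∷ zigzag x₂ y₂ allOld ++ x₃ ∷ zigzag x₃ y₃ allOld ++ rest

  hexagon : List V
  hexagon = x₁ ∷ y₁ ∷ x₃ ∷ y₃ ∷ x₂ ∷ y₂ ∷ x₁ ∷ []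

  loop : List V
  loop = gadget hexagon

  loop-∷ʳ : loop ∷ʳ c ≡ gadget (hexagon ∷ʳ c)
  loop-∷ʳ = cong (y₁ ∷_) (trans (Listₚ.++-assoc (zigzag y₁ x₁ others) _ (c ∷ []))
    (cong (λ ys → zigzag y₁ x₁ others ++ x₂ ∷ ys) (trans (Listₚ.++-assoc (zigzag x₂ y₂ allOld) _ (c ∷ []))
      (cong (λ ys → zigzag x₂ y₂ allOld ++ x₃ ∷ ys) (Listₚ.++-assoc (zigzag x₃ y₃ allOld) hexagon (c ∷ []))))))

  others-end : ∀ (p q : V) → zigzagEnd p q others ≡ p
  others-end p q = zigzagEnd-even p q t others
    (trans (Listₚ.length-map old (tabulate suc)) (trans (Listₚ.length-tabulate suc) r-even))

  R₁ R₂ R₃ : List V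
  R₃ = hexagon ∷ʳ c
  R₂ = x₃ ∷ zigzag x₃ y₃ allOld ++ R₃
  R₁ = x₂ ∷ zigzag x₂ y₂ allOld ++ R₂

  loop-walk : IsWalk (G ⊕ K₃₃) (c ∷ loop ∷ʳ c)
  loop-walk rewrite loop-∷ʳ =
    ⊕-left-right G K₃₃ zero 3F ∷ through 3F 0F (tabulate suc) R₁ (others-end y₁ x₁) (
    ⊕-right-right G K₃₃ 3F 1F ∷ through 1F 4F (allFin (suc r)) R₂ (others-end y₂ x₂) (
    ⊕-right-right G K₃₃ 4F 2F ∷ through 2F 5F (allFin (suc r)) R₃ (others-end y₃ x₃) (
    ⊕-right-right G K₃₃ 5F 0F ∷ ⊕-right-right G K₃₃ 0F 3F ∷ ⊕-right-right G K₃₃ 3F 2F ∷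
    ⊕-right-right G K₃₃ 2F 5F ∷ ⊕-right-right G K₃₃ 5F 1F ∷ ⊕-right-right G K₃₃ 1F 4F ∷
    ⊕-right-right G K₃₃ 4F 0F ∷ ⊕-right-left G K₃₃ 0F zero ∷ [])))
    where
    through : ∀ i j xs rs {e} → zigzagEnd (new i) (new j) (map old xs) ≡ e →
      IsWalk (G ⊕ K₃₃) (e ∷ rs) → IsWalk (G ⊕ K₃₃) (new i ∷ zigzag (new i) (new j) (map old xs) ++ rs)
    through i j xs rs end walk = walk-zigzag (G ⊕ K₃₃) (new i) (new j) (map old xs) rs
      (Allₚ.map⁺ (All.universal (λ x → ⊕-right-left G K₃₃ i x , ⊕-right-left G K₃₃ j x) xs))
      (subst (λ e → IsWalk (G ⊕ K₃₃) (e ∷ rs)) (≡.sym end) walk)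

  newSteps : List (V × V)
  newSteps = map (Product.map new new) k₃₃Steps

  -- The steps at c complete the zigzag from y₁ to one from x₁ through all of G.
  loop-uses : ∀ a b → edgeUses a b (c ∷ loop ∷ʳ c) ≡
    zigzagUses a b x₁ y₁ allOld + zigzagUses a b x₂ y₂ allOld + zigzagUses a b x₃ y₃ allOld
      + countᵇ (sameEdge a b) newSteps
  loop-uses a b = begin
    edgeUses a b (c ∷ loop ∷ʳ c)
      ≡⟨ cong (edgeUses a b ∘ (c ∷_)) loop-∷ʳ ⟩
    edgeUses a b (c ∷ y₁ ∷ zigzag y₁ x₁ others ++ R₁)
      ≡⟨ trans (edgeUses-∷∷ a b c y₁ _) (cong (S c y₁ +_) (through y₁ x₁ others R₁ (others-end y₁ x₁))) ⟩
    S c y₁ + (Z y₁ x₁ others + edgeUses a b (y₁ ∷ R₁))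
      ≡⟨ cong (λ u → S c y₁ + (Z y₁ x₁ others + u)) (trans (segment y₁ x₂ y₂ R₂)
           (cong (λ u → S y₁ x₂ + (Z x₂ y₂ allOld + u)) (trans (segment y₂ x₃ y₃ R₃)
             (cong (λ u → S y₂ x₃ + (Z x₃ y₃ allOld + u)) (countᵇ-sum (sameEdge a b) (steps (y₃ ∷ R₃))))))) ⟩
    S c y₁ + (Z y₁ x₁ others + (S y₁ x₂ + (Z x₂ y₂ allOld + (S y₂ x₃ + (Z x₃ y₃ allOld +
      (S y₃ x₁ + (S x₁ y₁ + (S y₁ x₃ + (S x₃ y₃ + (S y₃ x₂ + (S x₂ y₂ + (S y₂ x₁ + (S x₁ c + 0))))))))))))) 
      ≡⟨ regroup (S c y₁) (Z y₁ x₁ others) (S y₁ x₂) (Z x₂ y₂ allOld) (S y₂ x₃) (Z x₃ y₃ allOld)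
           (S y₃ x₁) (S x₁ y₁) (S y₁ x₃) (S x₃ y₃) (S y₃ x₂) (S x₂ y₂) (S y₂ x₁) (S x₁ c) ⟩
    S x₁ c + (S c y₁ + Z y₁ x₁ others) + Z x₂ y₂ allOld + Z x₃ y₃ allOld
      + (S y₁ x₂ + (S y₂ x₃ + (S y₃ x₁ + (S x₁ y₁ + (S y₁ x₃ + (S x₃ y₃ + (S y₃ x₂ + (S x₂ y₂ +
          (S y₂ x₁ + 0)))))))))
      ≡⟨ cong₂ _+_ (cong (λ u → u + Z x₂ y₂ allOld + Z x₃ y₃ allOld) (zigzagUses-∷ a b x₁ y₁ c others))
                   (countᵇ-sum (sameEdge a b) newSteps) ⟨
    Z x₁ y₁ allOld + Z x₂ y₂ allOld + Z x₃ y₃ allOld + countᵇ (sameEdge a b) newSteps ∎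
    where
    S = stepUses a b
    Z = zigzagUses a b
    through : ∀ p q js rs {e} → zigzagEnd p q js ≡ e →
      edgeUses a b (p ∷ zigzag p q js ++ rs) ≡ Z p q js + edgeUses a b (e ∷ rs)
    through p q js rs end =
      trans (edgeUses-zigzag a b p q js rs) (cong (λ e → Z p q js + edgeUses a b (e ∷ rs)) end)
    segment : ∀ p x y rs →
      edgeUses a b (p ∷ x ∷ zigzag x y allOld ++ rs) ≡ S p x + (Z x y allOld + edgeUses a b (y ∷ rs))
    segment p x y rs = trans (edgeUses-∷∷ a b p x _) (cong (S p x +_) (through x y allOld rs (others-end y x)))
    regroup : ∀ s₀ z₁ s₁ z₂ s₂ z₃ h₁ h₂ h₃ h₄ h₅ h₆ h₇ s₃ →
      s₀ + (z₁ + (s₁ + (z₂ + (s₂ + (z₃ + (h₁ + (h₂ + (h₃ + (h₄ + (h₅ + (h₆ + (h₇ + (s₃ + 0))))))))))))) ≡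
      s₃ + (s₀ + z₁) + z₂ + z₃ + (s₁ + (s₂ + (h₁ + (h₂ + (h₃ + (h₄ + (h₅ + (h₆ + (h₇ + 0)))))))))
    regroup = solve-∀

  allOld-avoids : ∀ i → All (_≢ new i) allOld
  allOld-avoids i = Allₚ.map⁺ (All.universal (λ _ → old≢new) (allFin (suc r)))

  zigzag-through : ∀ i y p q → p ≢ q → new i ≡ new p ⊎ new i ≡ new q →
    zigzagUses (new i) (old y) (new p) (new q) allOld ≡ 1
  zigzag-through i y p q p≢q on = begin
    zigzagUses (new i) (old y) (new p) (new q) allOld
      ≡⟨ zigzagUses-hub (new i) (old y) (new p) (new q) allOld on
           (p≢q ∘ new-injective) old≢new (allOld-avoids i) ⟩
    multiplicity (old y) (map old (allFin (suc r)))
      ≡⟨ multiplicity-map old-injective y (allFin (suc r)) ⟩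
    multiplicity y (allFin (suc r))
      ≡⟨ multiplicity-allFin y ⟩
    1 ∎

  zigzag-new-old : ∀ i y p q → p ≢ q →
    zigzagUses (new i) (old y) (new p) (new q) allOld ≡ indicator (⌊ i ≟ p ⌋ ∨ ⌊ i ≟ q ⌋)
  zigzag-new-old i y p q p≢q with i ≟ p | i ≟ q
  ... | yes refl | _        = zigzag-through i y p q p≢q (inj₁ refl)
  ... | no  _    | yes refl = zigzag-through i y p q p≢q (inj₂ refl)
  ... | no  i≢p  | no  i≢q  = zigzagUses-miss (new i) (old y) (new p) (new q)
    (i≢p ∘ new-injective ∘ ≡.sym) (i≢q ∘ new-injective ∘ ≡.sym) (allOld-avoids i)

  loop-tour : NewEdgeTour (c ∷ loop ∷ʳ c)
  loop-tour = record
    { old-old = λ x y → trans (loop-uses (old x) (old y)) (cong₂ _+_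
        (cong₂ _+_ (cong₂ _+_ (outside x y 0F 3F) (outside x y 1F 4F)) (outside x y 2F 5F))
        (newSteps-none (old x) (old y) (λ p q →
          sameEdge-false {a = old x} {old y} {new p} {new q} (inj₁ new≢old) (inj₁ new≢old))))
    ; new-old = λ i y → trans (loop-uses (new i) (old y)) (trans (cong₂ _+_
        (cong₂ _+_ (cong₂ _+_ (zigzag-new-old i y 0F 3F λ ()) (zigzag-new-old i y 1F 4F λ ()))
                   (zigzag-new-old i y 2F 5F λ ()))
        (newSteps-none (new i) (old y) (λ p q →
          sameEdge-false {a = new i} {old y} {new p} {new q} (inj₂ new≢old) (inj₁ new≢old))))
        (once i))
    ; new-new = λ i j ij → trans (loop-uses (new i) (new j)) (cong₂ _+_
        (cong₂ _+_ (cong₂ _+_ (disjoint i j 0F 3F) (disjoint i j 1F 4F)) (disjoint i j 2F 5F))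
        (trans (countᵇ-map (sameEdge (new i) (new j)) (Product.map new new) k₃₃Steps)
          (trans (countᵇ-cong (sameEdge-map new-injective i j) k₃₃Steps) (k₃₃Steps-once i j ij))))
    }
    where
    newSteps-none : ∀ a b → (∀ p q → sameEdge a b (new p , new q) ≡ false) → countᵇ (sameEdge a b) newSteps ≡ 0
    newSteps-none a b none = trans (countᵇ-map (sameEdge a b) (Product.map new new) k₃₃Steps)
      (countᵇ-none _ (All.universal (λ (p , q) → none p q) k₃₃Steps))
    outside : ∀ x y p q → zigzagUses (old x) (old y) (new p) (new q) allOld ≡ 0
    outside x y p q = zigzagUses-outside (old x) (old y) (new p) (new q) allOld new≢old new≢old new≢old new≢old
    disjoint : ∀ i j p q → zigzagUses (new i) (new j) (new p) (new q) allOld ≡ 0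
    disjoint i j p q = zigzagUses-disjoint (new i) (new j) (new p) (new q)
      (Allₚ.map⁺ (All.universal (λ _ → old≢new , old≢new) (allFin (suc r))))
    -- each new vertex lies on exactly one of the three zigzags
    once : ∀ i → indicator (⌊ i ≟ 0F ⌋ ∨ ⌊ i ≟ 3F ⌋) + indicator (⌊ i ≟ 1F ⌋ ∨ ⌊ i ≟ 4F ⌋)
                   + indicator (⌊ i ≟ 2F ⌋ ∨ ⌊ i ≟ 5F ⌋) + 0 ≡ 1
    once = decide₁ (λ i → _ ℕₚ.≟ 1)

-- Splicing

∷ʳ-splice : ∀ (xs : List A) z rs ps u → (xs ++ z ∷ rs ++ z ∷ ps) ∷ʳ u ≡ xs ++ z ∷ rs ++ z ∷ ps ∷ʳ u
∷ʳ-splice xs z rs ps u =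
  trans (Listₚ.++-assoc xs (z ∷ rs ++ z ∷ ps) (u ∷ []))
        (cong (λ ys → xs ++ z ∷ ys) (Listₚ.++-assoc rs (z ∷ ps) (u ∷ [])))

Pointwise-split : ∀ {R : A → B → Set} xs ys {x y xs′ ys′} → length xs ≡ length ys →
  Pointwise R (xs ++ x ∷ xs′) (ys ++ y ∷ ys′) → Pointwise R xs ys × R x y × Pointwise R xs′ ys′
Pointwise-split []       []       _   (xy ∷ rest) = [] , xy , rest
Pointwise-split (x ∷ xs) (y ∷ ys) len (xy ∷ rest) with Pointwise-split xs ys (ℕₚ.suc-injective len) rest
... | xs∼ys , x′∼y′ , rest∼ = (xy ∷ xs∼ys) , x′∼y′ , rest∼

module _ {r : ℕ} (H : Graph (suc r)) where

  open Blocks r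

  walk-old : ∀ xs → IsWalk H xs → IsWalk (H ⊕ K₃₃) (map old xs)
  walk-old xs walk rewrite steps-map old xs =
    Allₚ.map⁺ (All.map (λ {(x , y)} xy → trans (⊕-left-left H K₃₃ x y) xy) walk)

  eulerian-splice : ∀ {u vs} pre z post rs → vs ≡ pre ++ z ∷ post → EulerianCircuit H u vs →
    IsWalk (H ⊕ K₃₃) (old z ∷ rs ∷ʳ old z) → NewEdgeTour (old z ∷ rs ∷ʳ old z) →
    EulerianCircuit (H ⊕ K₃₃) (old u) (map old pre ++ old z ∷ rs ++ old z ∷ map old post)
  eulerian-splice {u} {vs} pre z post rs refl (walk , once) loop-walk tour =
    subst (IsWalk (H ⊕ K₃₃)) (≡.sym closed-new)
      (walk-splice (H ⊕ K₃₃) xs (old z) rs zs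
        (subst (IsWalk (H ⊕ K₃₃)) closed-old (walk-old _ walk)) loop-walk) ,
    uses
    where
    module tour = NewEdgeTour tour
    xs zs : List V
    xs = old u ∷ map old pre
    zs = map old post ∷ʳ old u
    circuit : List (Fin (suc r))
    circuit = u ∷ vs ∷ʳ u
    closed-new : old u ∷ (map old pre ++ old z ∷ rs ++ old z ∷ map old post) ∷ʳ old u
               ≡ xs ++ old z ∷ rs ++ old z ∷ zs
    closed-new = cong (old u ∷_) (∷ʳ-splice (map old pre) (old z) rs (map old post) (old u))
    closed-old : map old circuit ≡ xs ++ old z ∷ zs
    closed-old = cong (old u ∷_) (trans (Listₚ.map-++ old (pre ++ z ∷ post) (u ∷ []))
      (trans (cong (_++ old u ∷ []) (Listₚ.map-++ old pre (z ∷ post)))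
             (Listₚ.++-assoc (map old pre) _ (old u ∷ []))))
    split : ∀ a b → edgeUses a b (old u ∷ (map old pre ++ old z ∷ rs ++ old z ∷ map old post) ∷ʳ old u)
                  ≡ edgeUses a b (map old circuit) + edgeUses a b (old z ∷ rs ∷ʳ old z)
    split a b = trans (cong (edgeUses a b) closed-new) (trans (edgeUses-splice a b xs (old z) rs zs)
      (cong (λ ys → edgeUses a b ys + edgeUses a b (old z ∷ rs ∷ʳ old z)) (≡.sym closed-old)))
    no-new : ∀ i → All (_≢ new i) (map old circuit)
    no-new i = Allₚ.map⁺ (All.universal (λ _ → old≢new) circuit)
    uses : ∀ a b → Adj (H ⊕ K₃₃) a b ≡ true →
      edgeUses a b (old u ∷ (map old pre ++ old z ∷ rs ++ old z ∷ map old post) ∷ʳ old u) ≡ 1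
    uses a b ab with side (suc r) a | side (suc r) b
    ... | left x  | left y  = trans (split (old x) (old y)) (cong₂ _+_
      (trans (edgeUses-map old-injective x y circuit) (once x y (trans (≡.sym (⊕-left-left H K₃₃ x y)) ab)))
      (tour.old-old x y))
    ... | left x  | right j = trans (split (old x) (new j)) (cong₂ _+_
      (trans (edgeUses-sym (old x) (new j) (map old circuit)) (edgeUses-absent (new j) (old x) (no-new j)))
      (trans (edgeUses-sym (old x) (new j) (old z ∷ rs ∷ʳ old z)) (tour.new-old j x)))
    ... | right i | left y  = trans (split (new i) (old y)) (cong₂ _+_
      (edgeUses-absent (new i) (old y) (no-new i)) (tour.new-old i y))
    ... | right i | right j = trans (split (new i) (new j)) (cong₂ _+_
      (edgeUses-absent (new i) (new j) (no-new i))
      (tour.new-new i j (trans (≡.sym (⊕-right-right H K₃₃ i j)) ab)))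

  avoiding-splice : ∀ pre z post pre′ z′ post′ → length pre ≡ length pre′ →
    Avoiding H (pre ++ z ∷ post) (pre′ ++ z′ ∷ post′) → ∀ {rs rs′} → Avoiding (H ⊕ K₃₃) rs rs′ →
    Avoiding (H ⊕ K₃₃) (map old pre ++ old z ∷ rs ++ old z ∷ map old post)
                       (map old pre′ ++ old z′ ∷ rs′ ++ old z′ ∷ map old post′)
  avoiding-splice pre z post pre′ z′ post′ aligned avoiding loops
    with before , at-z , after ← Pointwise-split pre pre′ aligned avoiding =
    PW.++⁺ (lift before) (lift₁ at-z ∷ PW.++⁺ loops (lift₁ at-z ∷ lift after))
    where
    lift₁ : ∀ {v w} → v ≢ w × Adj H v w ≡ false → old v ≢ old w × Adj (H ⊕ K₃₃) (old v) (old w) ≡ false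
    lift₁ {v} {w} (v≢w , vw) = v≢w ∘ old-injective , trans (⊕-left-left H K₃₃ v w) vw
    lift : ∀ {vs ws} → Avoiding H vs ws → Avoiding (H ⊕ K₃₃) (map old vs) (map old ws)
    lift = PW.map⁺ old old ∘ PW.map lift₁

-- Aligned pairs of circuits

-- The gadget and its rotation are spliced in at the common position, keeping the circuits avoiding.
record AlignedCircuits {r} {H : Graph (suc r)} (ρ : Rotation H) (u : Fin (suc r)) : Set where
  field
    vs ws       : List (Fin (suc r))
    vs-eulerian : EulerianCircuit H u vs
    ws-eulerian : EulerianCircuit H u ws
    avoiding    : Avoiding H vs ws
    before after before′ after′ : List (Fin (suc r))
    vs-split    : vs ≡ before ++ zero ∷ after
    ws-split    : ws ≡ before′ ++ Rotation.to ρ zero ∷ after′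
    aligned     : length before ≡ length before′

module _ {r t} {H : Graph (suc r)} (ρ : Rotation H) (r-even : r ≡ t + t) where

  open Blocks r
  open Gadget {t = t} H r-even
  private
    module ρ = Rotation ρ
    ρ⁺ : Rotation (H ⊕ K₃₃)
    ρ⁺ = ρ ⊕ʳ K₃₃-rotation
    module ρ⁺ = Rotation ρ⁺

  aligned-old : ∀ {x} → AlignedCircuits ρ x → AlignedCircuits ρ⁺ (old x)
  aligned-old circuits = record
    { vs          = map old before ++ c ∷ loop ++ c ∷ map old after
    ; ws          = map old before′ ++ c′ ∷ map ρ⁺.to loop ++ c′ ∷ map old after′
    ; vs-eulerian = eulerian-splice H before zero after loop vs-split vs-eulerian loop-walk loop-tour
    ; ws-eulerian = eulerian-splice H before′ (ρ.to zero) after′ (map ρ⁺.to loop) ws-split ws-eulerian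
                      (subst (IsWalk (H ⊕ K₃₃)) rotated (ρ⁺.walk-map _ loop-walk))
                      (subst NewEdgeTour rotated
                        (newEdgeTour-map ρ.automorphism (Rotation.automorphism K₃₃-rotation) loop-tour))
    ; avoiding    = avoiding-splice H before zero after before′ (ρ.to zero) after′ aligned
                      (subst₂ (Avoiding H) vs-split ws-split avoiding) (ρ⁺.avoiding-rotated loop)
    ; before      = map old before
    ; after       = loop ++ c ∷ map old after
    ; before′     = map old before′
    ; after′      = map ρ⁺.to loop ++ c′ ∷ map old after′
    ; vs-split    = refl
    ; ws-split    = cong (λ v → map old before′ ++ v ∷ map ρ⁺.to loop ++ c′ ∷ map old after′) (≡.sym rotated-c)
    ; aligned     = trans (Listₚ.length-map old before) (trans aligned (≡.sym (Listₚ.length-map old before′)))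
    }
    where
    open AlignedCircuits circuits
    c′ : V
    c′ = old (ρ.to zero)
    rotated-c : ρ⁺.to c ≡ c′
    rotated-c = ⊕ᶠ-left ρ.to rotateSides zero
    rotated : map ρ⁺.to (c ∷ loop ∷ʳ c) ≡ c′ ∷ map ρ⁺.to loop ∷ʳ c′
    rotated = trans (cong (ρ⁺.to c ∷_) (Listₚ.map-++ ρ⁺.to loop (c ∷ [])))
                    (cong (λ v → v ∷ map ρ⁺.to loop ∷ʳ v) rotated-c)

module _ {r} {H : Graph (suc r)} (ρ : Rotation H) where

  private
    module ρ = Rotation ρ
    ρ₂ : Rotation ((H ⊕ K₃₃) ⊕ K₃₃)
    ρ₂ = (ρ ⊕ʳ K₃₃-rotation) ⊕ʳ K₃₃-rotation
    module ρ₂ = Rotation ρ₂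
    module σ = Automorphism (swapLast-automorphism H K₃₃)

  -- swapLast fixes both 0 and its rotation, so it preserves the alignment.
  aligned-swap : ∀ i → AlignedCircuits ρ₂ ((suc r ↑ʳ i) ↑ˡ 6) → AlignedCircuits ρ₂ ((suc r + 6) ↑ʳ i)
  aligned-swap i circuits = record
    { vs          = map σ.to vs
    ; ws          = map σ.to ws
    ; vs-eulerian = subst (λ u → EulerianCircuit H₂ u (map σ.to vs)) moved (σ.eulerian-map _ vs vs-eulerian)
    ; ws-eulerian = subst (λ u → EulerianCircuit H₂ u (map σ.to ws)) moved (σ.eulerian-map _ ws ws-eulerian)
    ; avoiding    = σ.avoiding-map avoiding
    ; before      = map σ.to before
    ; after       = map σ.to after
    ; before′     = map σ.to before′
    ; after′      = map σ.to after′
    ; vs-split    = trans (cong (map σ.to) vs-split) (trans (Listₚ.map-++ σ.to before (zero ∷ after))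
                      (cong (λ v → map σ.to before ++ v ∷ map σ.to after) (swapLast-base {suc r} {6} zero)))
    ; ws-split    = trans (cong (map σ.to) ws-split) (trans (Listₚ.map-++ σ.to before′ (ρ₂.to zero ∷ after′))
                      (cong (λ v → map σ.to before′ ++ v ∷ map σ.to after′) fixes-rotated-zero))
    ; aligned     = trans (Listₚ.length-map σ.to before) (trans aligned (≡.sym (Listₚ.length-map σ.to before′)))
    }
    where
    open AlignedCircuits circuits
    H₂ = (H ⊕ K₃₃) ⊕ K₃₃
    moved : σ.to ((suc r ↑ʳ i) ↑ˡ 6) ≡ (suc r + 6) ↑ʳ i
    moved = swapLast-middle {m = suc r} i
    rotated-zero : ρ₂.to zero ≡ (ρ.to zero ↑ˡ 6) ↑ˡ 6
    rotated-zero =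
      trans (⊕ᶠ-left (ρ.to ⊕ᶠ rotateSides) rotateSides zero) (cong (_↑ˡ 6) (⊕ᶠ-left ρ.to rotateSides zero))
    fixes-rotated-zero : σ.to (ρ₂.to zero) ≡ ρ₂.to zero
    fixes-rotated-zero =
      trans (cong σ.to rotated-zero) (trans (swapLast-base {n = 6} (ρ.to zero)) (≡.sym rotated-zero))

-- Odd-order graphs with a rotation, closed under joining with K₃,₃

record Stage : Set where
  field
    r half   : ℕ
    r-even   : r ≡ half + half
    graph    : Graph (suc r)
    rotation : Rotation graph

  order : ℕ
  order = suc r

  AllAligned : Set
  AllAligned = ∀ u → AlignedCircuits rotation u

_⊕K₃₃ : Stage → Stage
S ⊕K₃₃ = record
  { r        = r + 6
  ; half     = half + 3
  ; r-even   = trans (cong (_+ 6) r-even) (shift half)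
  ; graph    = graph ⊕ K₃₃
  ; rotation = rotation ⊕ʳ K₃₃-rotation
  }
  where
  open Stage S
  shift : ∀ t → t + t + 6 ≡ t + 3 + (t + 3)
  shift = solve-∀

_⊕K₃₃^_ : Stage → ℕ → Stage
S ⊕K₃₃^ zero  = S
S ⊕K₃₃^ suc k = (S ⊕K₃₃^ k) ⊕K₃₃

allAligned-⊕K₃₃ : ∀ S → Stage.AllAligned (S ⊕K₃₃) → Stage.AllAligned ((S ⊕K₃₃) ⊕K₃₃)
allAligned-⊕K₃₃ S aligned u = bySide (side (Stage.order S + 6) u)
  where
  open Stage (S ⊕K₃₃) using (half; rotation; r-even)
  bySide : ∀ {u} → Side (Stage.order S + 6) 6 u → AlignedCircuits (Stage.rotation ((S ⊕K₃₃) ⊕K₃₃)) u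
  bySide (left x)  = aligned-old {t = half} rotation r-even (aligned x)
  bySide (right i) =
    aligned-swap (Stage.rotation S) i (aligned-old {t = half} rotation r-even (aligned (Stage.order S ↑ʳ i)))

allAligned-⊕K₃₃^ : ∀ S → Stage.AllAligned (S ⊕K₃₃) → ∀ k → Stage.AllAligned (S ⊕K₃₃^ suc k)
allAligned-⊕K₃₃^ S aligned zero    = aligned
allAligned-⊕K₃₃^ S aligned (suc k) = allAligned-⊕K₃₃ (S ⊕K₃₃^ k) (allAligned-⊕K₃₃^ S aligned k)

doublyEulerian : ∀ S → Stage.AllAligned S → DoublyEulerian (Stage.graph S)
doublyEulerian S aligned u = vs , ws , vs-eulerian , ws-eulerian , avoiding
  where open AlignedCircuits (aligned u)

regular-⊕K₃₃ : ∀ {N} (G : Graph N) → 3 ≤ N → Regular G (N ∸ 3) → Regular (G ⊕ K₃₃) (N + 6 ∸ 3)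
regular-⊕K₃₃ {N} G 3≤N regular v with side N v
... | left x  = trans (⊕-degree-left G K₃₃ x) (trans (cong (_+ 6) (regular x)) (≡.sym (ℕₚ.+-∸-comm 6 3≤N)))
... | right j = trans (⊕-degree-right G K₃₃ j)
                  (trans (cong (N +_) (K₃₃-regular j)) (≡.sym (ℕₚ.+-∸-assoc N {6} {3} (ℕₚ.m≤m+n 3 3))))

regular-⊕K₃₃^ : ∀ S → 3 ≤ Stage.order S → Regular (Stage.graph S) (Stage.order S ∸ 3) →
  ∀ k → Regular (Stage.graph (S ⊕K₃₃^ k)) (Stage.order (S ⊕K₃₃^ k) ∸ 3)
regular-⊕K₃₃^ S 3≤N regular zero    = regular
regular-⊕K₃₃^ S 3≤N regular (suc k) =
  regular-⊕K₃₃ (Stage.graph (S ⊕K₃₃^ k)) (3≤order k) (regular-⊕K₃₃^ S 3≤N regular k)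
  where
  3≤order : ∀ k → 3 ≤ Stage.order (S ⊕K₃₃^ k)
  3≤order zero    = 3≤N
  3≤order (suc k) = ℕₚ.≤-trans (3≤order k) (ℕₚ.m≤m+n (Stage.order (S ⊕K₃₃^ k)) 6)

-- Certificates

eulerianCircuit? : ∀ (G : Graph n) u vs → Dec (EulerianCircuit G u vs)
eulerianCircuit? G u vs =
  All.all? (λ (a , b) → Adj G a b Bool.≟ true) (steps (u ∷ vs ∷ʳ u)) ×-dec
  Finₚ.all? (λ a → Finₚ.all? (λ b → (Adj G a b Bool.≟ true) →-dec (edgeUses a b (u ∷ vs ∷ʳ u) ℕₚ.≟ 1)))

avoiding? : ∀ (G : Graph n) vs ws → Dec (Avoiding G vs ws)
avoiding? G = PWₚ.decidable (λ v w → ¬? (v ≟ w) ×-dec (Adj G v w Bool.≟ false))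

-- Two circuits, with vertices written as natural numbers (read modulo the order), and the
-- position at which they visit 0 and its rotation.
record Certificate : Set where
  constructor certificate
  field
    vs ws    : List ℕ
    position : ℕ

module _ (S : Stage) where

  open Stage S

  vertices : List ℕ → List (Fin order)
  vertices = map (_mod order)

  Certifies : Fin order → Certificate → Set
  Certifies u (certificate vs ws i) =
    EulerianCircuit graph u (vertices vs) × EulerianCircuit graph u (vertices ws) ×
    Avoiding graph (vertices vs) (vertices ws) ×
    vertices vs ≡ take i (vertices vs) ++ zero ∷ drop (suc i) (vertices vs) ×
    vertices ws ≡ take i (vertices ws) ++ Rotation.to rotation zero ∷ drop (suc i) (vertices ws) ×
    length (take i (vertices vs)) ≡ length (take i (vertices ws))

  certifies? : ∀ u c → Dec (Certifies u c)
  certifies? u (certificate vs ws i) =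
    eulerianCircuit? graph u (vertices vs) ×-dec eulerianCircuit? graph u (vertices ws) ×-dec
    avoiding? graph (vertices vs) (vertices ws) ×-dec
    Listₚ.≡-dec _≟_ (vertices vs) _ ×-dec Listₚ.≡-dec _≟_ (vertices ws) _ ×-dec
    (length (take i (vertices vs)) ℕₚ.≟ length (take i (vertices ws)))

  aligned-certified : ∀ u c → Certifies u c → AlignedCircuits rotation u
  aligned-certified u (certificate vs ws i)
    (vs-eulerian , ws-eulerian , avoiding , vs-split , ws-split , aligned) = record
    { vs = vertices vs ; ws = vertices ws ; vs-eulerian = vs-eulerian ; ws-eulerian = ws-eulerian
    ; avoiding = avoiding ; vs-split = vs-split ; ws-split = ws-split ; aligned = aligned }

  allAligned-certified : (table : Fin order → Certificate) →
    {True (Finₚ.all? λ u → certifies? u (table u))} → AllAligned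
  allAligned-certified table {valid} u = aligned-certified u (table u) (toWitness valid u)

Solution : ℕ → Set
Solution n = Σ (Graph n) λ G → Connected G × Regular G (n ∸ 3) × DoublyEulerian G

solutions : ∀ S → 3 ≤ Stage.order S → Regular (Stage.graph S) (Stage.order S ∸ 3) →
  Stage.AllAligned (S ⊕K₃₃) → ∀ k → Solution (Stage.order (S ⊕K₃₃^ suc k))
solutions S 3≤N regular aligned k =
  Stage.graph (S ⊕K₃₃^ suc k) ,
  ⊕-connected (Stage.graph (S ⊕K₃₃^ k)) K₃₃ zero zero ,
  regular-⊕K₃₃^ S 3≤N regular (suc k) ,
  doublyEulerian (S ⊕K₃₃^ suc k) (allAligned-⊕K₃₃^ S aligned k)

cycleStage : ∀ t → Rotation (cycleComplement (t + t)) → Stage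
cycleStage t ρ = record
  { r = t + t ; half = t ; r-even = refl ; graph = cycleComplement (t + t) ; rotation = ρ }

stage₃ stage₅ stage₇ : Stage
stage₃ = cycleStage 1 (cycleComplement-rotation 2)
stage₅ = cycleStage 2 (cycleComplement-rotation 4)
stage₇ = cycleStage 3 (cycleComplement-rotation 6)

certificates₉ : Vec Certificate 9
certificates₉ =
    certificate
      (6 ∷ 4 ∷ 0 ∷ 7 ∷ 5 ∷ 6 ∷ 2 ∷ 5 ∷ 1 ∷ 6 ∷ 3 ∷ 8 ∷ 1 ∷ 4 ∷ 2 ∷ 3 ∷ 7 ∷ 2 ∷ 8 ∷ 4 ∷ 7 ∷ 1 ∷ 3 ∷
       0 ∷ 5 ∷ 8 ∷ [])
      (7 ∷ 5 ∷ 2 ∷ 8 ∷ 3 ∷ 7 ∷ 1 ∷ 4 ∷ 2 ∷ 7 ∷ 4 ∷ 6 ∷ 2 ∷ 3 ∷ 0 ∷ 4 ∷ 8 ∷ 1 ∷ 6 ∷ 5 ∷ 8 ∷ 0 ∷ 5 ∷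
       1 ∷ 3 ∷ 6 ∷ [])
      23
  ∷ certificate
      (7 ∷ 5 ∷ 6 ∷ 0 ∷ 5 ∷ 2 ∷ 4 ∷ 7 ∷ 3 ∷ 8 ∷ 0 ∷ 3 ∷ 6 ∷ 2 ∷ 8 ∷ 1 ∷ 3 ∷ 2 ∷ 7 ∷ 0 ∷ 4 ∷ 6 ∷ 1 ∷
       4 ∷ 8 ∷ 5 ∷ [])
      (6 ∷ 4 ∷ 7 ∷ 1 ∷ 4 ∷ 0 ∷ 3 ∷ 8 ∷ 5 ∷ 7 ∷ 2 ∷ 4 ∷ 8 ∷ 0 ∷ 6 ∷ 2 ∷ 5 ∷ 1 ∷ 8 ∷ 2 ∷ 3 ∷ 7 ∷ 0 ∷
       5 ∷ 6 ∷ 3 ∷ [])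
      3
  ∷ certificate
      (3 ∷ 0 ∷ 4 ∷ 6 ∷ 1 ∷ 5 ∷ 6 ∷ 3 ∷ 1 ∷ 8 ∷ 0 ∷ 7 ∷ 2 ∷ 8 ∷ 5 ∷ 2 ∷ 6 ∷ 0 ∷ 5 ∷ 7 ∷ 1 ∷ 4 ∷ 7 ∷
       3 ∷ 8 ∷ 4 ∷ [])
      (5 ∷ 1 ∷ 3 ∷ 8 ∷ 2 ∷ 4 ∷ 8 ∷ 5 ∷ 0 ∷ 7 ∷ 2 ∷ 6 ∷ 1 ∷ 7 ∷ 4 ∷ 0 ∷ 8 ∷ 1 ∷ 4 ∷ 6 ∷ 0 ∷ 3 ∷ 6 ∷
       5 ∷ 7 ∷ 3 ∷ [])
      1
  ∷ certificate
      (6 ∷ 2 ∷ 8 ∷ 4 ∷ 0 ∷ 6 ∷ 1 ∷ 7 ∷ 0 ∷ 8 ∷ 3 ∷ 2 ∷ 7 ∷ 5 ∷ 6 ∷ 4 ∷ 7 ∷ 3 ∷ 1 ∷ 4 ∷ 2 ∷ 5 ∷ 1 ∷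
       8 ∷ 5 ∷ 0 ∷ [])
      (8 ∷ 1 ∷ 6 ∷ 5 ∷ 1 ∷ 7 ∷ 0 ∷ 8 ∷ 2 ∷ 7 ∷ 4 ∷ 0 ∷ 6 ∷ 3 ∷ 7 ∷ 5 ∷ 8 ∷ 4 ∷ 2 ∷ 5 ∷ 0 ∷ 3 ∷ 2 ∷
       6 ∷ 4 ∷ 1 ∷ [])
      4
  ∷ certificate
      (7 ∷ 2 ∷ 6 ∷ 5 ∷ 1 ∷ 7 ∷ 5 ∷ 0 ∷ 6 ∷ 3 ∷ 1 ∷ 8 ∷ 3 ∷ 7 ∷ 0 ∷ 4 ∷ 8 ∷ 2 ∷ 5 ∷ 8 ∷ 0 ∷ 3 ∷ 2 ∷
       4 ∷ 6 ∷ 1 ∷ [])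
      (6 ∷ 1 ∷ 8 ∷ 3 ∷ 2 ∷ 6 ∷ 3 ∷ 1 ∷ 7 ∷ 5 ∷ 0 ∷ 7 ∷ 4 ∷ 8 ∷ 2 ∷ 5 ∷ 6 ∷ 0 ∷ 3 ∷ 7 ∷ 2 ∷ 4 ∷ 1 ∷
       5 ∷ 8 ∷ 0 ∷ [])
      7
  ∷ certificate
      (2 ∷ 3 ∷ 6 ∷ 1 ∷ 3 ∷ 0 ∷ 4 ∷ 6 ∷ 2 ∷ 8 ∷ 5 ∷ 1 ∷ 7 ∷ 5 ∷ 0 ∷ 8 ∷ 4 ∷ 2 ∷ 7 ∷ 4 ∷ 1 ∷ 8 ∷ 3 ∷
       7 ∷ 0 ∷ 6 ∷ [])
      (0 ∷ 4 ∷ 7 ∷ 2 ∷ 4 ∷ 1 ∷ 5 ∷ 8 ∷ 0 ∷ 7 ∷ 3 ∷ 2 ∷ 8 ∷ 3 ∷ 1 ∷ 6 ∷ 3 ∷ 0 ∷ 6 ∷ 5 ∷ 2 ∷ 6 ∷ 4 ∷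
       8 ∷ 1 ∷ 7 ∷ [])
      5
  ∷ certificate
      (4 ∷ 0 ∷ 7 ∷ 3 ∷ 0 ∷ 5 ∷ 2 ∷ 8 ∷ 4 ∷ 7 ∷ 2 ∷ 4 ∷ 1 ∷ 6 ∷ 5 ∷ 1 ∷ 8 ∷ 3 ∷ 6 ∷ 0 ∷ 8 ∷ 5 ∷ 7 ∷
       1 ∷ 3 ∷ 2 ∷ [])
      (3 ∷ 1 ∷ 6 ∷ 5 ∷ 1 ∷ 4 ∷ 0 ∷ 7 ∷ 3 ∷ 8 ∷ 0 ∷ 3 ∷ 2 ∷ 8 ∷ 4 ∷ 2 ∷ 7 ∷ 5 ∷ 8 ∷ 1 ∷ 7 ∷ 4 ∷ 6 ∷
       2 ∷ 5 ∷ 0 ∷ [])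
      1
  ∷ certificate
      (5 ∷ 0 ∷ 7 ∷ 2 ∷ 6 ∷ 1 ∷ 7 ∷ 4 ∷ 0 ∷ 8 ∷ 4 ∷ 2 ∷ 5 ∷ 8 ∷ 1 ∷ 5 ∷ 6 ∷ 0 ∷ 3 ∷ 1 ∷ 4 ∷ 6 ∷ 3 ∷
       8 ∷ 2 ∷ 3 ∷ [])
      (3 ∷ 2 ∷ 8 ∷ 0 ∷ 7 ∷ 2 ∷ 6 ∷ 3 ∷ 1 ∷ 6 ∷ 5 ∷ 0 ∷ 4 ∷ 6 ∷ 0 ∷ 3 ∷ 8 ∷ 1 ∷ 4 ∷ 2 ∷ 5 ∷ 8 ∷ 4 ∷
       7 ∷ 1 ∷ 5 ∷ [])
      8
  ∷ certificate
      (1 ∷ 5 ∷ 7 ∷ 1 ∷ 3 ∷ 0 ∷ 4 ∷ 2 ∷ 5 ∷ 8 ∷ 2 ∷ 6 ∷ 0 ∷ 7 ∷ 3 ∷ 6 ∷ 4 ∷ 7 ∷ 2 ∷ 3 ∷ 8 ∷ 4 ∷ 1 ∷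
       6 ∷ 5 ∷ 0 ∷ [])
      (2 ∷ 3 ∷ 8 ∷ 0 ∷ 4 ∷ 2 ∷ 5 ∷ 1 ∷ 3 ∷ 6 ∷ 1 ∷ 7 ∷ 2 ∷ 6 ∷ 4 ∷ 8 ∷ 5 ∷ 6 ∷ 0 ∷ 5 ∷ 7 ∷ 3 ∷ 0 ∷
       7 ∷ 4 ∷ 1 ∷ [])
      25
  ∷ []

certificates₁₁ : Vec Certificate 11
certificates₁₁ =
    certificate
      (9 ∷ 3 ∷ 7 ∷ 8 ∷ 4 ∷ 2 ∷ 8 ∷ 0 ∷ 3 ∷ 10 ∷ 0 ∷ 7 ∷ 4 ∷ 5 ∷ 1 ∷ 8 ∷ 3 ∷ 6 ∷ 9 ∷ 2 ∷ 5 ∷ 0 ∷ 2 ∷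
       10 ∷ 7 ∷ 1 ∷ 9 ∷ 4 ∷ 6 ∷ 2 ∷ 7 ∷ 9 ∷ 5 ∷ 10 ∷ 1 ∷ 6 ∷ 8 ∷ 5 ∷ 3 ∷ 1 ∷ 4 ∷ 10 ∷ 6 ∷ [])
      (8 ∷ 4 ∷ 6 ∷ 10 ∷ 3 ∷ 1 ∷ 10 ∷ 4 ∷ 2 ∷ 8 ∷ 1 ∷ 5 ∷ 3 ∷ 6 ∷ 0 ∷ 9 ∷ 4 ∷ 5 ∷ 8 ∷ 3 ∷ 7 ∷ 4 ∷ 1 ∷
       9 ∷ 6 ∷ 2 ∷ 10 ∷ 0 ∷ 7 ∷ 1 ∷ 6 ∷ 8 ∷ 7 ∷ 9 ∷ 2 ∷ 5 ∷ 10 ∷ 7 ∷ 2 ∷ 0 ∷ 3 ∷ 9 ∷ 5 ∷ [])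
      10
  ∷ certificate
      (8 ∷ 2 ∷ 4 ∷ 6 ∷ 10 ∷ 3 ∷ 0 ∷ 2 ∷ 7 ∷ 0 ∷ 9 ∷ 1 ∷ 4 ∷ 10 ∷ 1 ∷ 5 ∷ 3 ∷ 9 ∷ 2 ∷ 5 ∷ 9 ∷ 4 ∷ 8 ∷
       0 ∷ 10 ∷ 5 ∷ 4 ∷ 7 ∷ 1 ∷ 3 ∷ 6 ∷ 8 ∷ 7 ∷ 3 ∷ 8 ∷ 5 ∷ 0 ∷ 6 ∷ 9 ∷ 7 ∷ 10 ∷ 2 ∷ 6 ∷ [])
      (10 ∷ 3 ∷ 0 ∷ 7 ∷ 9 ∷ 4 ∷ 1 ∷ 3 ∷ 6 ∷ 4 ∷ 10 ∷ 2 ∷ 0 ∷ 8 ∷ 2 ∷ 7 ∷ 4 ∷ 8 ∷ 3 ∷ 7 ∷ 10 ∷ 0 ∷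
       9 ∷ 1 ∷ 8 ∷ 6 ∷ 0 ∷ 5 ∷ 2 ∷ 4 ∷ 5 ∷ 10 ∷ 6 ∷ 2 ∷ 9 ∷ 6 ∷ 1 ∷ 7 ∷ 8 ∷ 5 ∷ 9 ∷ 3 ∷ 5 ∷ [])
      6
  ∷ certificate
      (0 ∷ 7 ∷ 10 ∷ 1 ∷ 3 ∷ 7 ∷ 9 ∷ 4 ∷ 10 ∷ 5 ∷ 4 ∷ 1 ∷ 9 ∷ 5 ∷ 3 ∷ 8 ∷ 4 ∷ 6 ∷ 8 ∷ 7 ∷ 2 ∷ 4 ∷ 7 ∷
       1 ∷ 5 ∷ 8 ∷ 1 ∷ 6 ∷ 2 ∷ 8 ∷ 0 ∷ 6 ∷ 9 ∷ 3 ∷ 10 ∷ 0 ∷ 9 ∷ 2 ∷ 10 ∷ 6 ∷ 3 ∷ 0 ∷ 5 ∷ [])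
      (4 ∷ 6 ∷ 8 ∷ 0 ∷ 2 ∷ 5 ∷ 10 ∷ 3 ∷ 8 ∷ 7 ∷ 3 ∷ 0 ∷ 10 ∷ 6 ∷ 2 ∷ 9 ∷ 3 ∷ 5 ∷ 9 ∷ 6 ∷ 1 ∷ 3 ∷ 6 ∷
       0 ∷ 7 ∷ 9 ∷ 0 ∷ 5 ∷ 1 ∷ 9 ∷ 4 ∷ 7 ∷ 10 ∷ 2 ∷ 8 ∷ 4 ∷ 10 ∷ 1 ∷ 8 ∷ 5 ∷ 4 ∷ 1 ∷ 7 ∷ [])
      41
  ∷ certificate
      (10 ∷ 4 ∷ 9 ∷ 6 ∷ 10 ∷ 0 ∷ 7 ∷ 8 ∷ 6 ∷ 4 ∷ 5 ∷ 8 ∷ 4 ∷ 1 ∷ 9 ∷ 0 ∷ 8 ∷ 3 ∷ 0 ∷ 5 ∷ 1 ∷ 3 ∷ 6 ∷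
       1 ∷ 8 ∷ 2 ∷ 6 ∷ 0 ∷ 2 ∷ 4 ∷ 7 ∷ 1 ∷ 10 ∷ 2 ∷ 5 ∷ 10 ∷ 7 ∷ 2 ∷ 9 ∷ 7 ∷ 3 ∷ 9 ∷ 5 ∷ [])
      (8 ∷ 0 ∷ 10 ∷ 5 ∷ 8 ∷ 4 ∷ 5 ∷ 9 ∷ 7 ∷ 0 ∷ 6 ∷ 9 ∷ 0 ∷ 2 ∷ 10 ∷ 1 ∷ 9 ∷ 4 ∷ 1 ∷ 6 ∷ 2 ∷ 4 ∷ 7 ∷
       2 ∷ 9 ∷ 3 ∷ 5 ∷ 1 ∷ 3 ∷ 0 ∷ 5 ∷ 2 ∷ 8 ∷ 1 ∷ 7 ∷ 8 ∷ 6 ∷ 3 ∷ 10 ∷ 6 ∷ 4 ∷ 10 ∷ 7 ∷ [])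
      15
  ∷ certificate
      (5 ∷ 3 ∷ 10 ∷ 4 ∷ 7 ∷ 1 ∷ 10 ∷ 0 ∷ 3 ∷ 9 ∷ 4 ∷ 2 ∷ 0 ∷ 9 ∷ 7 ∷ 0 ∷ 6 ∷ 1 ∷ 3 ∷ 6 ∷ 9 ∷ 1 ∷ 5 ∷
       8 ∷ 6 ∷ 10 ∷ 7 ∷ 3 ∷ 8 ∷ 1 ∷ 4 ∷ 6 ∷ 2 ∷ 10 ∷ 5 ∷ 0 ∷ 8 ∷ 7 ∷ 2 ∷ 5 ∷ 9 ∷ 2 ∷ 8 ∷ [])
      (7 ∷ 2 ∷ 9 ∷ 0 ∷ 6 ∷ 2 ∷ 8 ∷ 1 ∷ 4 ∷ 8 ∷ 0 ∷ 3 ∷ 1 ∷ 10 ∷ 6 ∷ 1 ∷ 5 ∷ 2 ∷ 4 ∷ 5 ∷ 10 ∷ 0 ∷ 7 ∷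
       9 ∷ 5 ∷ 8 ∷ 6 ∷ 4 ∷ 10 ∷ 2 ∷ 0 ∷ 5 ∷ 3 ∷ 8 ∷ 7 ∷ 1 ∷ 9 ∷ 6 ∷ 3 ∷ 7 ∷ 10 ∷ 3 ∷ 9 ∷ [])
      7
  ∷ certificate
      (4 ∷ 6 ∷ 8 ∷ 3 ∷ 6 ∷ 10 ∷ 3 ∷ 5 ∷ 10 ∷ 4 ∷ 8 ∷ 2 ∷ 0 ∷ 9 ∷ 6 ∷ 2 ∷ 4 ∷ 7 ∷ 2 ∷ 5 ∷ 1 ∷ 6 ∷ 0 ∷
       3 ∷ 9 ∷ 7 ∷ 1 ∷ 10 ∷ 7 ∷ 0 ∷ 10 ∷ 2 ∷ 9 ∷ 5 ∷ 0 ∷ 8 ∷ 1 ∷ 9 ∷ 4 ∷ 1 ∷ 3 ∷ 7 ∷ 8 ∷ [])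
      (0 ∷ 7 ∷ 10 ∷ 4 ∷ 5 ∷ 9 ∷ 4 ∷ 7 ∷ 9 ∷ 0 ∷ 10 ∷ 3 ∷ 1 ∷ 8 ∷ 5 ∷ 3 ∷ 0 ∷ 6 ∷ 3 ∷ 7 ∷ 2 ∷ 5 ∷ 1 ∷
       4 ∷ 8 ∷ 6 ∷ 2 ∷ 9 ∷ 6 ∷ 1 ∷ 9 ∷ 3 ∷ 8 ∷ 7 ∷ 1 ∷ 10 ∷ 2 ∷ 8 ∷ 0 ∷ 2 ∷ 4 ∷ 6 ∷ 10 ∷ [])
      12
  ∷ certificate
      (0 ∷ 3 ∷ 7 ∷ 10 ∷ 3 ∷ 1 ∷ 7 ∷ 9 ∷ 1 ∷ 10 ∷ 0 ∷ 7 ∷ 2 ∷ 6 ∷ 3 ∷ 5 ∷ 10 ∷ 4 ∷ 6 ∷ 8 ∷ 2 ∷ 5 ∷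
       1 ∷ 8 ∷ 4 ∷ 9 ∷ 3 ∷ 8 ∷ 7 ∷ 4 ∷ 2 ∷ 10 ∷ 6 ∷ 1 ∷ 4 ∷ 5 ∷ 9 ∷ 2 ∷ 0 ∷ 5 ∷ 8 ∷ 0 ∷ 9 ∷ [])
      (1 ∷ 4 ∷ 5 ∷ 8 ∷ 4 ∷ 2 ∷ 5 ∷ 10 ∷ 2 ∷ 8 ∷ 1 ∷ 5 ∷ 3 ∷ 7 ∷ 4 ∷ 6 ∷ 8 ∷ 0 ∷ 5 ∷ 9 ∷ 3 ∷ 6 ∷ 2 ∷
       9 ∷ 0 ∷ 10 ∷ 4 ∷ 9 ∷ 6 ∷ 0 ∷ 3 ∷ 8 ∷ 7 ∷ 2 ∷ 0 ∷ 7 ∷ 10 ∷ 3 ∷ 1 ∷ 7 ∷ 9 ∷ 1 ∷ 10 ∷ [])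
      0
  ∷ certificate
      (0 ∷ 8 ∷ 2 ∷ 4 ∷ 6 ∷ 2 ∷ 0 ∷ 3 ∷ 1 ∷ 4 ∷ 8 ∷ 7 ∷ 1 ∷ 10 ∷ 4 ∷ 5 ∷ 0 ∷ 6 ∷ 8 ∷ 3 ∷ 6 ∷ 1 ∷ 5 ∷
       2 ∷ 10 ∷ 6 ∷ 9 ∷ 1 ∷ 8 ∷ 5 ∷ 9 ∷ 2 ∷ 7 ∷ 10 ∷ 3 ∷ 7 ∷ 4 ∷ 9 ∷ 0 ∷ 10 ∷ 5 ∷ 3 ∷ 9 ∷ [])
      (1 ∷ 10 ∷ 3 ∷ 0 ∷ 5 ∷ 3 ∷ 1 ∷ 4 ∷ 2 ∷ 0 ∷ 9 ∷ 5 ∷ 2 ∷ 9 ∷ 3 ∷ 7 ∷ 4 ∷ 5 ∷ 10 ∷ 2 ∷ 7 ∷ 0 ∷ 6 ∷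
       1 ∷ 9 ∷ 7 ∷ 8 ∷ 0 ∷ 10 ∷ 6 ∷ 8 ∷ 1 ∷ 5 ∷ 8 ∷ 2 ∷ 6 ∷ 3 ∷ 8 ∷ 4 ∷ 9 ∷ 6 ∷ 4 ∷ 10 ∷ [])
      0
  ∷ certificate
      (4 ∷ 9 ∷ 7 ∷ 2 ∷ 0 ∷ 7 ∷ 1 ∷ 3 ∷ 5 ∷ 4 ∷ 1 ∷ 5 ∷ 0 ∷ 6 ∷ 9 ∷ 5 ∷ 2 ∷ 10 ∷ 7 ∷ 8 ∷ 2 ∷ 6 ∷ 3 ∷
       10 ∷ 1 ∷ 9 ∷ 2 ∷ 4 ∷ 7 ∷ 3 ∷ 9 ∷ 0 ∷ 10 ∷ 5 ∷ 8 ∷ 6 ∷ 10 ∷ 4 ∷ 6 ∷ 1 ∷ 8 ∷ 3 ∷ 0 ∷ [])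
      (0 ∷ 10 ∷ 5 ∷ 3 ∷ 1 ∷ 5 ∷ 2 ∷ 4 ∷ 6 ∷ 0 ∷ 2 ∷ 6 ∷ 1 ∷ 7 ∷ 8 ∷ 6 ∷ 3 ∷ 8 ∷ 5 ∷ 9 ∷ 3 ∷ 7 ∷ 4 ∷
       8 ∷ 2 ∷ 10 ∷ 3 ∷ 0 ∷ 5 ∷ 4 ∷ 10 ∷ 1 ∷ 9 ∷ 6 ∷ 10 ∷ 7 ∷ 9 ∷ 0 ∷ 7 ∷ 2 ∷ 9 ∷ 4 ∷ 1 ∷ [])
      4
  ∷ certificate
      (7 ∷ 4 ∷ 5 ∷ 2 ∷ 4 ∷ 6 ∷ 10 ∷ 5 ∷ 0 ∷ 6 ∷ 9 ∷ 3 ∷ 7 ∷ 0 ∷ 8 ∷ 5 ∷ 9 ∷ 0 ∷ 10 ∷ 4 ∷ 1 ∷ 9 ∷ 4 ∷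
       8 ∷ 2 ∷ 6 ∷ 1 ∷ 3 ∷ 0 ∷ 2 ∷ 10 ∷ 7 ∷ 1 ∷ 10 ∷ 3 ∷ 8 ∷ 1 ∷ 5 ∷ 3 ∷ 6 ∷ 8 ∷ 7 ∷ 2 ∷ [])
      (5 ∷ 0 ∷ 6 ∷ 3 ∷ 0 ∷ 7 ∷ 9 ∷ 6 ∷ 1 ∷ 7 ∷ 8 ∷ 4 ∷ 5 ∷ 1 ∷ 10 ∷ 6 ∷ 8 ∷ 1 ∷ 9 ∷ 0 ∷ 2 ∷ 8 ∷ 0 ∷
       10 ∷ 3 ∷ 7 ∷ 2 ∷ 4 ∷ 1 ∷ 3 ∷ 8 ∷ 5 ∷ 2 ∷ 9 ∷ 4 ∷ 10 ∷ 2 ∷ 6 ∷ 4 ∷ 7 ∷ 10 ∷ 5 ∷ 3 ∷ [])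
      8
  ∷ certificate
      (4 ∷ 2 ∷ 7 ∷ 0 ∷ 6 ∷ 4 ∷ 1 ∷ 5 ∷ 10 ∷ 3 ∷ 7 ∷ 4 ∷ 9 ∷ 2 ∷ 6 ∷ 9 ∷ 1 ∷ 7 ∷ 10 ∷ 6 ∷ 8 ∷ 7 ∷ 9 ∷
       3 ∷ 5 ∷ 8 ∷ 0 ∷ 10 ∷ 2 ∷ 5 ∷ 4 ∷ 8 ∷ 1 ∷ 3 ∷ 0 ∷ 9 ∷ 5 ∷ 0 ∷ 2 ∷ 8 ∷ 3 ∷ 6 ∷ 1 ∷ [])
      (0 ∷ 3 ∷ 6 ∷ 1 ∷ 5 ∷ 0 ∷ 2 ∷ 7 ∷ 9 ∷ 4 ∷ 6 ∷ 0 ∷ 8 ∷ 3 ∷ 5 ∷ 8 ∷ 2 ∷ 6 ∷ 9 ∷ 5 ∷ 10 ∷ 6 ∷ 8 ∷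
       4 ∷ 7 ∷ 10 ∷ 1 ∷ 9 ∷ 3 ∷ 7 ∷ 0 ∷ 9 ∷ 2 ∷ 4 ∷ 1 ∷ 8 ∷ 7 ∷ 1 ∷ 3 ∷ 10 ∷ 4 ∷ 5 ∷ 2 ∷ [])
      3
  ∷ []

certificates₁₃ : Vec Certificate 13
certificates₁₃ =
    certificate
      (10 ∷ 6 ∷ 7 ∷ 12 ∷ 3 ∷ 10 ∷ 5 ∷ 1 ∷ 11 ∷ 0 ∷ 12 ∷ 1 ∷ 10 ∷ 4 ∷ 9 ∷ 0 ∷ 3 ∷ 11 ∷ 7 ∷ 3 ∷ 6 ∷
       12 ∷ 9 ∷ 2 ∷ 5 ∷ 11 ∷ 9 ∷ 10 ∷ 2 ∷ 8 ∷ 12 ∷ 2 ∷ 7 ∷ 10 ∷ 8 ∷ 0 ∷ 4 ∷ 12 ∷ 5 ∷ 3 ∷ 8 ∷ 4 ∷ 1 ∷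
       3 ∷ 9 ∷ 5 ∷ 0 ∷ 2 ∷ 6 ∷ 9 ∷ 1 ∷ 6 ∷ 4 ∷ 11 ∷ 6 ∷ 8 ∷ 5 ∷ 7 ∷ 4 ∷ 2 ∷ 11 ∷ 8 ∷ 1 ∷ 7 ∷ [])
      (12 ∷ 5 ∷ 8 ∷ 11 ∷ 4 ∷ 12 ∷ 6 ∷ 2 ∷ 10 ∷ 1 ∷ 11 ∷ 2 ∷ 12 ∷ 3 ∷ 8 ∷ 1 ∷ 4 ∷ 10 ∷ 9 ∷ 4 ∷ 0 ∷
       11 ∷ 7 ∷ 3 ∷ 6 ∷ 10 ∷ 8 ∷ 12 ∷ 1 ∷ 9 ∷ 11 ∷ 3 ∷ 9 ∷ 12 ∷ 7 ∷ 1 ∷ 5 ∷ 11 ∷ 6 ∷ 4 ∷ 7 ∷ 5 ∷ 2 ∷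
       4 ∷ 8 ∷ 6 ∷ 1 ∷ 3 ∷ 0 ∷ 8 ∷ 2 ∷ 0 ∷ 5 ∷ 10 ∷ 0 ∷ 7 ∷ 6 ∷ 9 ∷ 5 ∷ 3 ∷ 10 ∷ 7 ∷ 2 ∷ 9 ∷ [])
      9
  ∷ certificate
      (5 ∷ 9 ∷ 0 ∷ 4 ∷ 1 ∷ 6 ∷ 2 ∷ 5 ∷ 12 ∷ 6 ∷ 11 ∷ 2 ∷ 9 ∷ 3 ∷ 5 ∷ 10 ∷ 3 ∷ 11 ∷ 1 ∷ 3 ∷ 6 ∷ 7 ∷
       1 ∷ 9 ∷ 6 ∷ 4 ∷ 8 ∷ 2 ∷ 4 ∷ 9 ∷ 11 ∷ 0 ∷ 10 ∷ 8 ∷ 6 ∷ 10 ∷ 4 ∷ 12 ∷ 0 ∷ 2 ∷ 10 ∷ 9 ∷ 12 ∷ 1 ∷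
       10 ∷ 7 ∷ 5 ∷ 11 ∷ 4 ∷ 7 ∷ 3 ∷ 12 ∷ 2 ∷ 7 ∷ 11 ∷ 8 ∷ 12 ∷ 7 ∷ 0 ∷ 5 ∷ 8 ∷ 0 ∷ 3 ∷ 8 ∷ [])
      (6 ∷ 8 ∷ 1 ∷ 5 ∷ 2 ∷ 0 ∷ 3 ∷ 6 ∷ 11 ∷ 0 ∷ 10 ∷ 3 ∷ 8 ∷ 4 ∷ 6 ∷ 12 ∷ 4 ∷ 10 ∷ 2 ∷ 4 ∷ 0 ∷ 9 ∷
       2 ∷ 8 ∷ 0 ∷ 5 ∷ 7 ∷ 3 ∷ 5 ∷ 8 ∷ 10 ∷ 1 ∷ 12 ∷ 7 ∷ 0 ∷ 12 ∷ 5 ∷ 11 ∷ 1 ∷ 3 ∷ 12 ∷ 8 ∷ 11 ∷ 2 ∷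
       12 ∷ 9 ∷ 6 ∷ 10 ∷ 5 ∷ 9 ∷ 4 ∷ 11 ∷ 3 ∷ 9 ∷ 10 ∷ 7 ∷ 11 ∷ 9 ∷ 1 ∷ 4 ∷ 7 ∷ 6 ∷ 2 ∷ 7 ∷ [])
      2
  ∷ certificate
      (9 ∷ 11 ∷ 5 ∷ 1 ∷ 6 ∷ 4 ∷ 2 ∷ 11 ∷ 1 ∷ 10 ∷ 2 ∷ 6 ∷ 11 ∷ 0 ∷ 3 ∷ 8 ∷ 0 ∷ 12 ∷ 5 ∷ 9 ∷ 6 ∷ 3 ∷
       11 ∷ 8 ∷ 6 ∷ 10 ∷ 5 ∷ 2 ∷ 8 ∷ 5 ∷ 7 ∷ 1 ∷ 12 ∷ 4 ∷ 11 ∷ 7 ∷ 2 ∷ 0 ∷ 10 ∷ 7 ∷ 4 ∷ 9 ∷ 1 ∷ 3 ∷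
       12 ∷ 9 ∷ 0 ∷ 4 ∷ 8 ∷ 10 ∷ 3 ∷ 7 ∷ 0 ∷ 5 ∷ 3 ∷ 9 ∷ 10 ∷ 4 ∷ 1 ∷ 8 ∷ 12 ∷ 6 ∷ 7 ∷ 12 ∷ [])
      (8 ∷ 10 ∷ 4 ∷ 0 ∷ 5 ∷ 3 ∷ 1 ∷ 12 ∷ 0 ∷ 11 ∷ 1 ∷ 5 ∷ 12 ∷ 6 ∷ 2 ∷ 9 ∷ 1 ∷ 10 ∷ 6 ∷ 8 ∷ 5 ∷ 2 ∷
       12 ∷ 7 ∷ 5 ∷ 11 ∷ 4 ∷ 1 ∷ 7 ∷ 4 ∷ 8 ∷ 0 ∷ 10 ∷ 3 ∷ 12 ∷ 8 ∷ 1 ∷ 6 ∷ 11 ∷ 8 ∷ 3 ∷ 7 ∷ 0 ∷ 2 ∷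
       10 ∷ 7 ∷ 6 ∷ 3 ∷ 9 ∷ 12 ∷ 4 ∷ 9 ∷ 6 ∷ 4 ∷ 2 ∷ 7 ∷ 11 ∷ 3 ∷ 0 ∷ 9 ∷ 10 ∷ 5 ∷ 9 ∷ 11 ∷ [])
      16
  ∷ certificate
      (8 ∷ 1 ∷ 4 ∷ 7 ∷ 10 ∷ 5 ∷ 12 ∷ 0 ∷ 11 ∷ 7 ∷ 3 ∷ 5 ∷ 11 ∷ 3 ∷ 6 ∷ 12 ∷ 7 ∷ 1 ∷ 9 ∷ 11 ∷ 6 ∷ 1 ∷
       5 ∷ 2 ∷ 11 ∷ 1 ∷ 12 ∷ 2 ∷ 4 ∷ 8 ∷ 5 ∷ 7 ∷ 6 ∷ 8 ∷ 2 ∷ 10 ∷ 6 ∷ 2 ∷ 0 ∷ 4 ∷ 12 ∷ 9 ∷ 5 ∷ 0 ∷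
       8 ∷ 10 ∷ 3 ∷ 1 ∷ 10 ∷ 4 ∷ 11 ∷ 8 ∷ 12 ∷ 3 ∷ 0 ∷ 10 ∷ 9 ∷ 6 ∷ 4 ∷ 9 ∷ 0 ∷ 7 ∷ 2 ∷ 9 ∷ [])
      (9 ∷ 2 ∷ 5 ∷ 9 ∷ 11 ∷ 6 ∷ 10 ∷ 1 ∷ 12 ∷ 8 ∷ 4 ∷ 6 ∷ 12 ∷ 4 ∷ 0 ∷ 10 ∷ 8 ∷ 2 ∷ 7 ∷ 12 ∷ 0 ∷ 2 ∷
       6 ∷ 3 ∷ 12 ∷ 2 ∷ 10 ∷ 3 ∷ 5 ∷ 7 ∷ 4 ∷ 9 ∷ 0 ∷ 7 ∷ 3 ∷ 11 ∷ 0 ∷ 3 ∷ 1 ∷ 5 ∷ 10 ∷ 7 ∷ 6 ∷ 1 ∷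
       7 ∷ 11 ∷ 4 ∷ 2 ∷ 11 ∷ 5 ∷ 12 ∷ 9 ∷ 10 ∷ 4 ∷ 1 ∷ 11 ∷ 8 ∷ 0 ∷ 5 ∷ 8 ∷ 6 ∷ 9 ∷ 1 ∷ 8 ∷ [])
      7
  ∷ certificate
      (10 ∷ 5 ∷ 8 ∷ 12 ∷ 7 ∷ 6 ∷ 1 ∷ 11 ∷ 2 ∷ 12 ∷ 6 ∷ 8 ∷ 3 ∷ 1 ∷ 5 ∷ 2 ∷ 4 ∷ 7 ∷ 2 ∷ 10 ∷ 7 ∷ 5 ∷
       3 ∷ 7 ∷ 0 ∷ 11 ∷ 9 ∷ 0 ∷ 12 ∷ 4 ∷ 6 ∷ 3 ∷ 0 ∷ 10 ∷ 9 ∷ 1 ∷ 10 ∷ 3 ∷ 11 ∷ 4 ∷ 1 ∷ 8 ∷ 0 ∷ 4 ∷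
       9 ∷ 3 ∷ 12 ∷ 9 ∷ 5 ∷ 12 ∷ 1 ∷ 7 ∷ 11 ∷ 5 ∷ 0 ∷ 2 ∷ 9 ∷ 6 ∷ 10 ∷ 8 ∷ 2 ∷ 6 ∷ 11 ∷ 8 ∷ [])
      (12 ∷ 6 ∷ 7 ∷ 11 ∷ 8 ∷ 0 ∷ 2 ∷ 12 ∷ 3 ∷ 10 ∷ 0 ∷ 7 ∷ 4 ∷ 2 ∷ 6 ∷ 3 ∷ 5 ∷ 9 ∷ 3 ∷ 11 ∷ 9 ∷ 6 ∷
       4 ∷ 8 ∷ 1 ∷ 10 ∷ 7 ∷ 1 ∷ 11 ∷ 5 ∷ 0 ∷ 4 ∷ 1 ∷ 12 ∷ 8 ∷ 2 ∷ 11 ∷ 4 ∷ 10 ∷ 5 ∷ 2 ∷ 9 ∷ 1 ∷ 5 ∷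
       7 ∷ 2 ∷ 10 ∷ 8 ∷ 6 ∷ 11 ∷ 0 ∷ 9 ∷ 10 ∷ 6 ∷ 1 ∷ 3 ∷ 8 ∷ 5 ∷ 12 ∷ 7 ∷ 3 ∷ 0 ∷ 12 ∷ 9 ∷ [])
      24
  ∷ certificate
      (7 ∷ 1 ∷ 3 ∷ 12 ∷ 6 ∷ 7 ∷ 10 ∷ 2 ∷ 12 ∷ 0 ∷ 3 ∷ 9 ∷ 5 ∷ 8 ∷ 12 ∷ 4 ∷ 2 ∷ 9 ∷ 0 ∷ 8 ∷ 11 ∷ 0 ∷
       5 ∷ 10 ∷ 8 ∷ 6 ∷ 3 ∷ 5 ∷ 1 ∷ 11 ∷ 4 ∷ 8 ∷ 2 ∷ 6 ∷ 9 ∷ 11 ∷ 6 ∷ 10 ∷ 4 ∷ 9 ∷ 12 ∷ 5 ∷ 11 ∷ 3 ∷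
       10 ∷ 0 ∷ 4 ∷ 7 ∷ 11 ∷ 2 ∷ 0 ∷ 7 ∷ 3 ∷ 8 ∷ 1 ∷ 10 ∷ 9 ∷ 1 ∷ 6 ∷ 4 ∷ 1 ∷ 12 ∷ 7 ∷ 2 ∷ [])
      (9 ∷ 2 ∷ 4 ∷ 11 ∷ 0 ∷ 9 ∷ 12 ∷ 3 ∷ 11 ∷ 1 ∷ 4 ∷ 8 ∷ 6 ∷ 7 ∷ 11 ∷ 5 ∷ 3 ∷ 8 ∷ 1 ∷ 7 ∷ 10 ∷ 1 ∷
       6 ∷ 12 ∷ 7 ∷ 0 ∷ 4 ∷ 6 ∷ 2 ∷ 10 ∷ 5 ∷ 7 ∷ 3 ∷ 0 ∷ 8 ∷ 10 ∷ 0 ∷ 12 ∷ 5 ∷ 8 ∷ 11 ∷ 6 ∷ 10 ∷ 4 ∷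
       12 ∷ 1 ∷ 3 ∷ 9 ∷ 10 ∷ 3 ∷ 6 ∷ 9 ∷ 4 ∷ 7 ∷ 2 ∷ 12 ∷ 8 ∷ 2 ∷ 0 ∷ 5 ∷ 2 ∷ 11 ∷ 9 ∷ 1 ∷ [])
      9
  ∷ certificate
      (8 ∷ 10 ∷ 1 ∷ 6 ∷ 3 ∷ 11 ∷ 7 ∷ 5 ∷ 3 ∷ 12 ∷ 7 ∷ 4 ∷ 1 ∷ 12 ∷ 5 ∷ 10 ∷ 7 ∷ 3 ∷ 1 ∷ 9 ∷ 6 ∷ 7 ∷
       0 ∷ 9 ∷ 4 ∷ 12 ∷ 8 ∷ 11 ∷ 5 ∷ 8 ∷ 0 ∷ 12 ∷ 9 ∷ 10 ∷ 3 ∷ 9 ∷ 5 ∷ 1 ∷ 7 ∷ 2 ∷ 11 ∷ 4 ∷ 2 ∷ 0 ∷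
       5 ∷ 2 ∷ 10 ∷ 0 ∷ 4 ∷ 10 ∷ 6 ∷ 11 ∷ 0 ∷ 3 ∷ 8 ∷ 4 ∷ 6 ∷ 2 ∷ 8 ∷ 1 ∷ 11 ∷ 9 ∷ 2 ∷ 12 ∷ [])
      (7 ∷ 11 ∷ 0 ∷ 5 ∷ 2 ∷ 12 ∷ 9 ∷ 4 ∷ 2 ∷ 10 ∷ 9 ∷ 3 ∷ 0 ∷ 10 ∷ 4 ∷ 11 ∷ 9 ∷ 2 ∷ 0 ∷ 7 ∷ 5 ∷ 9 ∷
       6 ∷ 8 ∷ 5 ∷ 10 ∷ 7 ∷ 12 ∷ 4 ∷ 7 ∷ 1 ∷ 10 ∷ 8 ∷ 11 ∷ 2 ∷ 8 ∷ 4 ∷ 0 ∷ 8 ∷ 1 ∷ 12 ∷ 3 ∷ 1 ∷ 6 ∷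
       4 ∷ 1 ∷ 11 ∷ 6 ∷ 3 ∷ 11 ∷ 5 ∷ 12 ∷ 6 ∷ 2 ∷ 7 ∷ 3 ∷ 5 ∷ 1 ∷ 9 ∷ 0 ∷ 12 ∷ 8 ∷ 3 ∷ 10 ∷ [])
      30
  ∷ certificate
      (4 ∷ 0 ∷ 8 ∷ 2 ∷ 5 ∷ 0 ∷ 9 ∷ 3 ∷ 0 ∷ 2 ∷ 6 ∷ 10 ∷ 7 ∷ 2 ∷ 4 ∷ 10 ∷ 9 ∷ 4 ∷ 1 ∷ 12 ∷ 6 ∷ 8 ∷
       3 ∷ 5 ∷ 9 ∷ 11 ∷ 5 ∷ 7 ∷ 3 ∷ 1 ∷ 9 ∷ 12 ∷ 2 ∷ 9 ∷ 6 ∷ 1 ∷ 5 ∷ 12 ∷ 8 ∷ 4 ∷ 12 ∷ 3 ∷ 6 ∷ 7 ∷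
       12 ∷ 0 ∷ 10 ∷ 3 ∷ 11 ∷ 4 ∷ 6 ∷ 11 ∷ 1 ∷ 10 ∷ 2 ∷ 11 ∷ 8 ∷ 5 ∷ 10 ∷ 8 ∷ 1 ∷ 7 ∷ 0 ∷ 11 ∷ [])
      (5 ∷ 1 ∷ 9 ∷ 3 ∷ 6 ∷ 1 ∷ 7 ∷ 4 ∷ 1 ∷ 3 ∷ 0 ∷ 12 ∷ 8 ∷ 3 ∷ 5 ∷ 11 ∷ 8 ∷ 5 ∷ 2 ∷ 11 ∷ 0 ∷ 9 ∷
       4 ∷ 6 ∷ 7 ∷ 10 ∷ 6 ∷ 8 ∷ 4 ∷ 2 ∷ 7 ∷ 11 ∷ 3 ∷ 7 ∷ 0 ∷ 2 ∷ 6 ∷ 11 ∷ 9 ∷ 5 ∷ 10 ∷ 4 ∷ 0 ∷ 8 ∷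
       10 ∷ 1 ∷ 11 ∷ 4 ∷ 12 ∷ 5 ∷ 0 ∷ 10 ∷ 2 ∷ 12 ∷ 3 ∷ 10 ∷ 9 ∷ 6 ∷ 12 ∷ 9 ∷ 2 ∷ 8 ∷ 1 ∷ 12 ∷ [])
      1
  ∷ certificate
      (12 ∷ 2 ∷ 0 ∷ 12 ∷ 4 ∷ 6 ∷ 7 ∷ 1 ∷ 11 ∷ 5 ∷ 10 ∷ 1 ∷ 5 ∷ 0 ∷ 4 ∷ 1 ∷ 6 ∷ 10 ∷ 7 ∷ 2 ∷ 4 ∷ 7 ∷
       11 ∷ 2 ∷ 6 ∷ 12 ∷ 3 ∷ 11 ∷ 0 ∷ 3 ∷ 8 ∷ 4 ∷ 9 ∷ 6 ∷ 8 ∷ 1 ∷ 3 ∷ 9 ∷ 1 ∷ 12 ∷ 9 ∷ 5 ∷ 2 ∷ 9 ∷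
       11 ∷ 6 ∷ 3 ∷ 10 ∷ 0 ∷ 9 ∷ 10 ∷ 2 ∷ 8 ∷ 10 ∷ 4 ∷ 11 ∷ 8 ∷ 0 ∷ 7 ∷ 3 ∷ 5 ∷ 7 ∷ 12 ∷ 5 ∷ [])
      (10 ∷ 3 ∷ 1 ∷ 10 ∷ 5 ∷ 0 ∷ 8 ∷ 2 ∷ 12 ∷ 6 ∷ 11 ∷ 2 ∷ 6 ∷ 1 ∷ 5 ∷ 2 ∷ 0 ∷ 11 ∷ 8 ∷ 3 ∷ 5 ∷ 8 ∷
       12 ∷ 3 ∷ 0 ∷ 10 ∷ 4 ∷ 12 ∷ 1 ∷ 4 ∷ 9 ∷ 5 ∷ 7 ∷ 0 ∷ 9 ∷ 2 ∷ 4 ∷ 7 ∷ 2 ∷ 10 ∷ 7 ∷ 6 ∷ 3 ∷ 7 ∷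
       12 ∷ 0 ∷ 4 ∷ 11 ∷ 1 ∷ 7 ∷ 11 ∷ 3 ∷ 9 ∷ 11 ∷ 5 ∷ 12 ∷ 9 ∷ 1 ∷ 8 ∷ 4 ∷ 6 ∷ 9 ∷ 10 ∷ 6 ∷ [])
      2
  ∷ certificate
      (0 ∷ 10 ∷ 1 ∷ 9 ∷ 4 ∷ 10 ∷ 8 ∷ 11 ∷ 0 ∷ 5 ∷ 9 ∷ 12 ∷ 8 ∷ 0 ∷ 2 ∷ 4 ∷ 11 ∷ 7 ∷ 12 ∷ 0 ∷ 7 ∷
       10 ∷ 2 ∷ 12 ∷ 5 ∷ 2 ∷ 9 ∷ 11 ∷ 2 ∷ 8 ∷ 1 ∷ 12 ∷ 4 ∷ 6 ∷ 7 ∷ 1 ∷ 11 ∷ 6 ∷ 2 ∷ 7 ∷ 4 ∷ 8 ∷ 5 ∷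
       3 ∷ 0 ∷ 4 ∷ 1 ∷ 3 ∷ 8 ∷ 6 ∷ 10 ∷ 3 ∷ 7 ∷ 5 ∷ 10 ∷ 9 ∷ 6 ∷ 12 ∷ 3 ∷ 11 ∷ 5 ∷ 1 ∷ 6 ∷ 3 ∷ [])
      (6 ∷ 11 ∷ 0 ∷ 8 ∷ 3 ∷ 11 ∷ 7 ∷ 10 ∷ 1 ∷ 6 ∷ 8 ∷ 10 ∷ 9 ∷ 1 ∷ 3 ∷ 5 ∷ 12 ∷ 9 ∷ 11 ∷ 1 ∷ 8 ∷
       12 ∷ 3 ∷ 10 ∷ 6 ∷ 3 ∷ 7 ∷ 12 ∷ 1 ∷ 7 ∷ 2 ∷ 11 ∷ 5 ∷ 0 ∷ 9 ∷ 2 ∷ 10 ∷ 0 ∷ 3 ∷ 9 ∷ 5 ∷ 7 ∷ 6 ∷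
       4 ∷ 1 ∷ 5 ∷ 2 ∷ 4 ∷ 7 ∷ 0 ∷ 12 ∷ 2 ∷ 8 ∷ 4 ∷ 11 ∷ 8 ∷ 5 ∷ 10 ∷ 4 ∷ 12 ∷ 6 ∷ 2 ∷ 0 ∷ 4 ∷ [])
      8
  ∷ certificate
      (8 ∷ 2 ∷ 9 ∷ 12 ∷ 7 ∷ 11 ∷ 2 ∷ 12 ∷ 5 ∷ 2 ∷ 6 ∷ 9 ∷ 10 ∷ 0 ∷ 12 ∷ 6 ∷ 7 ∷ 10 ∷ 6 ∷ 4 ∷ 7 ∷ 0 ∷
       8 ∷ 3 ∷ 6 ∷ 1 ∷ 3 ∷ 9 ∷ 11 ∷ 8 ∷ 1 ∷ 7 ∷ 2 ∷ 10 ∷ 5 ∷ 0 ∷ 11 ∷ 1 ∷ 5 ∷ 3 ∷ 11 ∷ 4 ∷ 12 ∷ 8 ∷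
       4 ∷ 0 ∷ 2 ∷ 4 ∷ 9 ∷ 0 ∷ 3 ∷ 7 ∷ 5 ∷ 11 ∷ 6 ∷ 8 ∷ 5 ∷ 9 ∷ 1 ∷ 12 ∷ 3 ∷ 10 ∷ 4 ∷ 1 ∷ [])
      (7 ∷ 3 ∷ 8 ∷ 10 ∷ 9 ∷ 12 ∷ 3 ∷ 10 ∷ 6 ∷ 3 ∷ 0 ∷ 8 ∷ 11 ∷ 1 ∷ 10 ∷ 0 ∷ 9 ∷ 11 ∷ 0 ∷ 5 ∷ 9 ∷ 1 ∷
       7 ∷ 4 ∷ 0 ∷ 2 ∷ 4 ∷ 8 ∷ 12 ∷ 7 ∷ 2 ∷ 9 ∷ 3 ∷ 11 ∷ 6 ∷ 1 ∷ 12 ∷ 2 ∷ 6 ∷ 4 ∷ 10 ∷ 5 ∷ 11 ∷ 7 ∷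
       5 ∷ 1 ∷ 3 ∷ 5 ∷ 8 ∷ 1 ∷ 4 ∷ 9 ∷ 6 ∷ 12 ∷ 0 ∷ 7 ∷ 6 ∷ 8 ∷ 2 ∷ 11 ∷ 4 ∷ 12 ∷ 5 ∷ 2 ∷ [])
      13
  ∷ certificate
      (6 ∷ 10 ∷ 0 ∷ 3 ∷ 5 ∷ 9 ∷ 4 ∷ 7 ∷ 5 ∷ 1 ∷ 3 ∷ 10 ∷ 5 ∷ 11 ∷ 4 ∷ 0 ∷ 11 ∷ 9 ∷ 1 ∷ 11 ∷ 7 ∷ 3 ∷
       8 ∷ 10 ∷ 1 ∷ 4 ∷ 2 ∷ 0 ∷ 5 ∷ 8 ∷ 2 ∷ 6 ∷ 12 ∷ 8 ∷ 6 ∷ 1 ∷ 8 ∷ 4 ∷ 10 ∷ 7 ∷ 12 ∷ 4 ∷ 6 ∷ 7 ∷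
       0 ∷ 12 ∷ 2 ∷ 7 ∷ 1 ∷ 12 ∷ 9 ∷ 6 ∷ 3 ∷ 12 ∷ 5 ∷ 2 ∷ 11 ∷ 3 ∷ 9 ∷ 10 ∷ 2 ∷ 9 ∷ 0 ∷ 8 ∷ [])
      (0 ∷ 12 ∷ 1 ∷ 4 ∷ 6 ∷ 8 ∷ 5 ∷ 9 ∷ 6 ∷ 2 ∷ 4 ∷ 12 ∷ 6 ∷ 10 ∷ 5 ∷ 1 ∷ 10 ∷ 8 ∷ 2 ∷ 10 ∷ 9 ∷ 4 ∷
       7 ∷ 12 ∷ 2 ∷ 5 ∷ 3 ∷ 1 ∷ 6 ∷ 7 ∷ 3 ∷ 0 ∷ 10 ∷ 7 ∷ 0 ∷ 2 ∷ 7 ∷ 5 ∷ 12 ∷ 9 ∷ 11 ∷ 5 ∷ 0 ∷ 9 ∷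
       1 ∷ 11 ∷ 3 ∷ 9 ∷ 2 ∷ 11 ∷ 8 ∷ 0 ∷ 4 ∷ 11 ∷ 6 ∷ 3 ∷ 10 ∷ 4 ∷ 8 ∷ 12 ∷ 3 ∷ 8 ∷ 1 ∷ 7 ∷ [])
      2
  ∷ certificate
      (8 ∷ 0 ∷ 3 ∷ 7 ∷ 4 ∷ 11 ∷ 3 ∷ 5 ∷ 9 ∷ 6 ∷ 2 ∷ 9 ∷ 0 ∷ 12 ∷ 4 ∷ 0 ∷ 2 ∷ 8 ∷ 1 ∷ 12 ∷ 6 ∷ 10 ∷
       3 ∷ 12 ∷ 2 ∷ 4 ∷ 6 ∷ 1 ∷ 3 ∷ 9 ∷ 1 ∷ 10 ∷ 5 ∷ 8 ∷ 3 ∷ 6 ∷ 7 ∷ 0 ∷ 11 ∷ 5 ∷ 2 ∷ 10 ∷ 4 ∷ 1 ∷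
       7 ∷ 10 ∷ 0 ∷ 5 ∷ 1 ∷ 11 ∷ 7 ∷ 12 ∷ 5 ∷ 7 ∷ 2 ∷ 11 ∷ 9 ∷ 4 ∷ 8 ∷ 11 ∷ 6 ∷ 8 ∷ 10 ∷ 9 ∷ [])
      (9 ∷ 1 ∷ 4 ∷ 8 ∷ 5 ∷ 10 ∷ 4 ∷ 6 ∷ 7 ∷ 0 ∷ 3 ∷ 7 ∷ 1 ∷ 11 ∷ 5 ∷ 1 ∷ 3 ∷ 9 ∷ 2 ∷ 11 ∷ 0 ∷ 12 ∷
       4 ∷ 11 ∷ 3 ∷ 5 ∷ 0 ∷ 2 ∷ 4 ∷ 7 ∷ 2 ∷ 12 ∷ 6 ∷ 9 ∷ 4 ∷ 0 ∷ 8 ∷ 1 ∷ 10 ∷ 6 ∷ 3 ∷ 12 ∷ 5 ∷ 2 ∷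
       8 ∷ 12 ∷ 1 ∷ 6 ∷ 2 ∷ 10 ∷ 8 ∷ 11 ∷ 6 ∷ 8 ∷ 3 ∷ 10 ∷ 7 ∷ 5 ∷ 9 ∷ 10 ∷ 0 ∷ 9 ∷ 11 ∷ 7 ∷ [])
      1
  ∷ []

solutions₃ : ∀ k → Solution (Stage.order (stage₃ ⊕K₃₃^ suc k))
solutions₃ = solutions stage₃ (s≤s (s≤s (s≤s z≤n))) (decide₁ (λ v → degree (cycleComplement 2) v ℕₚ.≟ 0))
  (allAligned-certified (stage₃ ⊕K₃₃) (lookup certificates₉))

solutions₅ : ∀ k → Solution (Stage.order (stage₅ ⊕K₃₃^ suc k))
solutions₅ = solutions stage₅ (s≤s (s≤s (s≤s z≤n))) (decide₁ (λ v → degree (cycleComplement 4) v ℕₚ.≟ 2))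
  (allAligned-certified (stage₅ ⊕K₃₃) (lookup certificates₁₁))

solutions₇ : ∀ k → Solution (Stage.order (stage₇ ⊕K₃₃^ suc k))
solutions₇ = solutions stage₇ (s≤s (s≤s (s≤s z≤n))) (decide₁ (λ v → degree (cycleComplement 6) v ℕₚ.≟ 4))
  (allAligned-certified (stage₇ ⊕K₃₃) (lookup certificates₁₃))

Family : Stage → ℕ → Set
Family S n = Σ ℕ λ k → n ≡ Stage.order (S ⊕K₃₃^ suc k)

family-+6 : ∀ S {n} → Family S n → Family S (6 + n)
family-+6 S (k , refl) = suc k , ℕₚ.+-comm 6 (Stage.order (S ⊕K₃₃^ suc k))

decompose : ∀ m → (9 + m) % 2 ≡ 1 → Family stage₃ (9 + m) ⊎ Family stage₅ (9 + m) ⊎ Family stage₇ (9 + m)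
decompose 0 _  = inj₁ (0 , refl)
decompose 1 ()
decompose 2 _  = inj₂ (inj₁ (0 , refl))
decompose 3 ()
decompose 4 _  = inj₂ (inj₂ (0 , refl))
decompose 5 ()
decompose (suc (suc (suc (suc (suc (suc m)))))) odd =
  Sum.map (family-+6 stage₃) (Sum.map (family-+6 stage₅) (family-+6 stage₇))
    (decompose m (trans (≡.sym ([m+kn]%n≡m%n (9 + m) 3 2)) (trans (cong (_% 2) (ℕₚ.+-comm (9 + m) 6)) odd)))

solution : ∀ m → (9 + m) % 2 ≡ 1 → Solution (9 + m)
solution m odd with decompose m odd
... | inj₁ (k , n≡)        = subst Solution (≡.sym n≡) (solutions₃ k)
... | inj₂ (inj₁ (k , n≡)) = subst Solution (≡.sym n≡) (solutions₅ k)
... | inj₂ (inj₂ (k , n≡)) = subst Solution (≡.sym n≡) (solutions₇ k)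

theorem2 : (n : ℕ) → 9 ≤ n → n % 2 ≡ 1 →
    Σ (Graph n) λ G → Connected G × Regular G (n ∸ 3) × DoublyEulerian G
theorem2 n 9≤n odd = subst Solution 9+[n∸9]≡n (solution (n ∸ 9) (subst (λ k → k % 2 ≡ 1) (≡.sym 9+[n∸9]≡n) odd))
  where
  9+[n∸9]≡n : 9 + (n ∸ 9) ≡ n
  9+[n∸9]≡n = ℕₚ.m+[n∸m]≡n 9≤n
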